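{- If $D$ is an $n$-vertex digraph, then the multiplicity of $-1$ as a root of $A_D(t)$ is at most $n-s_2(n)$, where $s_2(n)$ is the number of $1$'s in the binary expansion of $n$. Moreover, for every positive integer $n$ there exists an $n$-vertex digraph $D$ with \[A_D(t)=\frac{n!}{2^{\,n-s_2(n)}}(1+t)^{n-s_2(n)}.\]
   Context: A digraph $D=(V,E)$ has finite vertex set $V$ and arc set $E\subseteq V\times V$ with no loops (no multiple arcs). For an $n$-vertex digraph $D$, a descent of a bijection $\sigma:V\to[n]$ is an arc $u\to v$ with $\sigma(u)>\sigma(v)$, $\mathrm{des}_D(\sigma)$ is the number of descents, and $A_D(t)=\sum_{\sigma}t^{\mathrm{des}_D(\sigma)}$ summed over all bijections $\sigma:V\to[n]$. -}

module Defs where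

open import Data.Bool using (Bool; true; false; _∧_; if_then_else_; not)
open import Data.Nat using (ℕ; zero; suc; _≡ᵇ_; _<ᵇ_; _∸_; _^_)
open import Data.Nat.DivMod using (_/_; _%_)
open import Data.Nat.Properties using (m^n≢0)
open import Data.Nat using (_!)
open import Data.Bool.ListAction using (and)
open import Data.Integer as ℤ using (ℤ; +_)
open import Data.Fin using (Fin; toℕ)
open import Data.Vec using (Vec; []; _∷_; lookup)
open import Data.List using (List; []; _∷_; map; concatMap; filter; length; allFin; replicate)
open import Data.Product using (∃; _×_; _,_)
open import Relation.Binary.PropositionalEquality using (_≡_)
open import Relation.Nullary.Decidable using (Dec)
open import Data.Bool.Properties using (T?)

-- Digraphs on the vertex set Fin n (no loops; simple by construction:
-- the arc set is a Boolean relation, so no multiple arcs).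

record Digraph (n : ℕ) : Set where
  field
    arc     : Fin n → Fin n → Bool
    loopless : ∀ v → arc v v ≡ false
open Digraph public

-- Enumeration of all bijections σ : Fin n → Fin n
-- (all functions, filtered to the injective ones; on Fin n injective ⇔ bijective).

allVecs : (n m : ℕ) → List (Vec (Fin n) m)
allVecs n zero    = [] ∷ []
allVecs n (suc m) = concatMap (λ i → map (i ∷_) (allVecs n m)) (allFin n)

_==ᶠ_ : ∀ {n} → Fin n → Fin n → Bool
i ==ᶠ j = toℕ i ≡ᵇ toℕ j

isInjective : ∀ {n} → (Fin n → Fin n) → Bool
isInjective {n} f =
  and (concatMap (λ i → map (λ j → if i ==ᶠ j then true else not (f i ==ᶠ f j)) (allFin n)) (allFin n))

allBijections : (n : ℕ) → List (Fin n → Fin n)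
allBijections n = filter (λ f → T? (isInjective f)) (map lookup (allVecs n n))

count : ∀ {A : Set} → (A → Bool) → List A → ℕ
count p xs = length (filter (λ x → T? (p x)) xs)

des : ∀ {n} → Digraph n → (Fin n → Fin n) → ℕ
des {n} D σ =
  count (λ uv → let u = Data.Product.proj₁ uv ; v = Data.Product.proj₂ uv
                in arc D u v ∧ (toℕ (σ v) <ᵇ toℕ (σ u)))
        (concatMap (λ u → map (λ v → (u , v)) (allFin n)) (allFin n))

-- Integer polynomials as coefficient lists (constant term first).

Poly : Set
Poly = List ℤ

coeff : Poly → ℕ → ℤ
coeff []       _       = + 0
coeff (a ∷ p)  zero    = a
coeff (a ∷ p)  (suc k) = coeff p k

_+P_ : Poly → Poly → Poly
[]      +P q       = q
p       +P []      = p
(a ∷ p) +P (b ∷ q) = (a ℤ.+ b) ∷ (p +P q)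

scale : ℤ → Poly → Poly
scale c p = map (c ℤ.*_) p

_*P_ : Poly → Poly → Poly
[]      *P q = []
(a ∷ p) *P q = scale a q +P (+ 0 ∷ (p *P q))

_^P_ : Poly → ℕ → Poly
p ^P zero  = + 1 ∷ []
p ^P suc k = p *P (p ^P k)

_≈P_ : Poly → Poly → Set
p ≈P q = ∀ k → coeff p k ≡ coeff q k

_∣P_ : Poly → Poly → Set
d ∣P p = ∃ λ q → (d *P q) ≈P p

onePlusT : Poly
onePlusT = + 1 ∷ + 1 ∷ []

-- A_D(t) = Σ_σ t^{des_D(σ)}; coefficient of t^k is #{σ : des σ = k}.
-- (des ≤ n·n, so n·n+1 coefficients suffice.)

A : ∀ {n} → Digraph n → Poly
A {n} D = map (λ k → + count (λ σ → des D σ ≡ᵇ k) (allBijections n)) (Data.List.upTo (suc (n Data.Nat.* n)))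

-- s₂(n): number of 1's in the binary expansion of n (fuel n suffices).

s2-aux : ℕ → ℕ → ℕ
s2-aux zero    _ = 0
s2-aux (suc f) m = m % 2 Data.Nat.+ s2-aux f (m / 2)

s2 : ℕ → ℕ
s2 n = s2-aux n n

factDivPow2 : ℕ → ℕ → ℕ
factDivPow2 n k = _/_ (n !) (2 ^ k) {{m^n≢0 2 k}}

-- Evaluating at t = 1 gives A_D(1) = n!, so (1 + t)^m ∣ A_D forces 2^m ∣ n!, and by Legendre's formula
-- the exponent of 2 in n! is n − s₂(n).
--
-- Conversely, let u, v be non-adjacent vertices of a digraph H with an automorphism exchanging them. Then
-- H + uv ≅ H + vu, while for each bijection σ exactly one of the arcs uv, vu is a descent; hence
-- A_{H+uv} = A_{H+vu} = (1 + t) A_H / 2. The binomial tree B(k + 1), two copies of B(k) with their roots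
-- joined, is built from the empty digraph by such insertions, and so is any disjoint union of binomial
-- trees. The forest whose trees have the binary digits of n as sizes has n vertices and n − s₂(n) arcs,
-- so its descent polynomial is n! / 2^(n − s₂(n)) · (1 + t)^(n − s₂(n)).

module Submission where

import Algebra.Properties.CommutativeSemigroup as CommutativeSemigroupₚ
open import Data.Bool using (Bool; true; false; _∧_; _∨_; not; T; if_then_else_)
open import Data.Bool.ListAction using (and)
open import Data.Bool.Properties using (T?; T-≡; T-not-≡; T-∧; T-∨; ∧-zeroʳ; ∧-identityʳ; ∨-identityʳ)
open import Data.Empty using (⊥-elim)
open import Data.Fin as Fin using (Fin; toℕ; _↑ˡ_; _↑ʳ_; splitAt; join)
open import Data.Fin.Permutation as Permutation using (Permutation′; _⟨$⟩ʳ_; _⟨$⟩ˡ_; inverseˡ; inverseʳ)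
import Data.Fin.Properties as Finₚ
open import Data.Integer as ℤ using (ℤ; ∣_∣)
import Data.Integer.Properties as ℤₚ
import Data.Integer.Tactic.RingSolver as ℤ-Solver
open import Data.List using (List; []; _∷_; _++_; map; concatMap; filter; length; allFin; upTo; applyUpTo; cartesianProductWith; cartesianProduct)
open import Data.List.Membership.Propositional using (_∈_)
open import Data.List.Membership.Propositional.Properties using (∈-allFin; ∈-map⁺; ∈-filter⁻; ∈-cartesianProductWith⁺)
open import Data.List.Membership.Propositional.Properties.WithK using (unique∧set⇒bag)
import Data.List.Properties as Listₚ
open import Data.List.Relation.Binary.BagAndSetEquality using (∼bag⇒↭)
open import Data.List.Relation.Binary.Permutation.Propositional using (_↭_)
open import Data.List.Relation.Binary.Permutation.Propositional.Properties using (↭-length; filter-↭)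
open import Data.List.Relation.Unary.All as All using (All; []; _∷_)
import Data.List.Relation.Unary.All.Properties as Allₚ
open import Data.List.Relation.Unary.AllPairs using ([]; _∷_)
open import Data.List.Relation.Unary.Any using (here; there)
open import Data.List.Relation.Unary.Unique.Propositional using (Unique)
import Data.List.Relation.Unary.Unique.Propositional.Properties as Uniqueₚ
open import Data.Maybe as Maybe using (Maybe; just; nothing)
import Data.Maybe.Properties as Maybeₚ
open import Data.Nat using (ℕ; NonZero; zero; suc; _+_; _*_; _∸_; _^_; _!; _≤_; _<_; _≡ᵇ_; _<ᵇ_; z≤n; s≤s)
open import Data.Nat.Combinatorics using (_C_; nPn≡n!; nCk+nC[k+1]≡[n+1]C[k+1])
open import Data.Nat.Combinatorics.Base using (_P′_)
open import Data.Nat.DivMod using (_/_; _%_; m≡m%n+[m/n]*n; m%n<n; m/n<m; m*n/n≡m)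
open import Data.Nat.Divisibility using (_∣_; _∤_; divides; n∣m*n; ∣m+n∣m⇒∣n; ∣1⇒≡1; ∣-trans; *-cancelˡ-∣)
open import Data.Nat.Induction using (<-rec)
open import Data.Nat.ListAction using (sum)
open import Data.Nat.ListAction.Properties using (sum-++)
open import Data.Nat.Primality using (Prime; prime?; euclidsLemma)
open import Data.Nat.Properties hiding (_≟_)
open import Data.Nat.Tactic.RingSolver using (solve-∀)
open import Data.Product using (∃; ∃₂; _×_; _,_; proj₁; proj₂)
open import Data.Sum as Sum using (_⊎_; inj₁; inj₂)
import Data.Sum.Properties as Sumₚ
open import Data.Unit using (tt)
open import Data.Vec as Vec using (Vec; []; _∷_; lookup)
import Data.Vec.Properties as Vecₚ
open import Function using (_∘_; id; const; _⇔_; mk⇔; Equivalence)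
open import Function.Definitions using (Injective)
open import Relation.Binary.Definitions using (tri<; tri≈; tri>)
open import Relation.Binary.PropositionalEquality
open import Relation.Nullary using (¬_; yes; no; does)
open import Relation.Nullary.Decidable using (dec-true; dec-false; from-yes)

open import Defs
open Finₚ using (_≟_)
open CommutativeSemigroupₚ +-commutativeSemigroup using () renaming (interchange to +-interchange)

private variable
  X Y Z : Set
  n m : ℕ

indicator : Bool → ℕ
indicator true  = 1
indicator false = 0

count-∷ : (p : X → Bool) (x : X) (xs : List X) → count p (x ∷ xs) ≡ indicator (p x) + count p xs
count-∷ p x xs with p x
... | true  = refl
... | false = refl

count-cong : {p q : X → Bool} (xs : List X) → (∀ x → p x ≡ q x) → count p xs ≡ count q xs
count-cong         []       p≗q = refl
count-cong {p = p} {q} (x ∷ xs) p≗q = begin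
  count p (x ∷ xs)                    ≡⟨ count-∷ p x xs ⟩
  indicator (p x) + count p xs        ≡⟨ cong₂ _+_ (cong indicator (p≗q x)) (count-cong xs p≗q) ⟩
  indicator (q x) + count q xs        ≡⟨ count-∷ q x xs ⟨
  count q (x ∷ xs)                    ∎
  where open ≡-Reasoning

count-false : (xs : List X) → count (λ _ → false) xs ≡ 0
count-false []       = refl
count-false (x ∷ xs) = count-false xs

count-true : (xs : List X) → count (λ _ → true) xs ≡ length xs
count-true []       = refl
count-true (x ∷ xs) = cong suc (count-true xs)

count-none : {p : X → Bool} {xs : List X} → All (λ x → p x ≡ false) xs → count p xs ≡ 0
count-none         []         = refl
count-none {p = p} {x ∷ xs} (px ∷ pxs) = trans (count-∷ p x xs) (cong₂ _+_ (cong indicator px) (count-none pxs))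

count≤length : (p : X → Bool) (xs : List X) → count p xs ≤ length xs
count≤length p = Listₚ.length-filter (T? ∘ p)

count-++ : (p : X → Bool) (xs ys : List X) → count p (xs ++ ys) ≡ count p xs + count p ys
count-++ p xs ys = trans (cong length (Listₚ.filter-++ (T? ∘ p) xs ys)) (Listₚ.length-++ (filter (T? ∘ p) xs))

count-map : (p : Y → Bool) (f : X → Y) (xs : List X) → count p (map f xs) ≡ count (p ∘ f) xs
count-map p f []       = refl
count-map p f (x ∷ xs) = begin
  count p (f x ∷ map f xs)               ≡⟨ count-∷ p (f x) (map f xs) ⟩
  indicator (p (f x)) + count p (map f xs) ≡⟨ cong (indicator (p (f x)) +_) (count-map p f xs) ⟩
  indicator (p (f x)) + count (p ∘ f) xs   ≡⟨ count-∷ (p ∘ f) x xs ⟨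
  count (p ∘ f) (x ∷ xs)                 ∎
  where open ≡-Reasoning

count-filter : (q p : X → Bool) (xs : List X) → count p (filter (T? ∘ q) xs) ≡ count (λ x → q x ∧ p x) xs
count-filter q p []       = refl
count-filter q p (x ∷ xs) = begin
  count p (filter (T? ∘ q) (x ∷ xs))                      ≡⟨ head-step ⟩
  indicator (q x ∧ p x) + count p (filter (T? ∘ q) xs)    ≡⟨ cong (indicator (q x ∧ p x) +_) (count-filter q p xs) ⟩
  indicator (q x ∧ p x) + count (λ x → q x ∧ p x) xs      ≡⟨ count-∷ (λ x → q x ∧ p x) x xs ⟨
  count (λ x → q x ∧ p x) (x ∷ xs)                        ∎
  where
  open ≡-Reasoning
  head-step : count p (filter (T? ∘ q) (x ∷ xs)) ≡ indicator (q x ∧ p x) + count p (filter (T? ∘ q) xs)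
  head-step with q x
  ... | true  = count-∷ p x _
  ... | false = refl

count-cartesianProductWith : (p : Z → Bool) (f : X → Y → Z) (xs : List X) (ys : List Y) →
  count p (cartesianProductWith f xs ys) ≡ sum (map (λ x → count (p ∘ f x) ys) xs)
count-cartesianProductWith p f []       ys = refl
count-cartesianProductWith p f (x ∷ xs) ys = begin
  count p (map (f x) ys ++ cartesianProductWith f xs ys)
    ≡⟨ count-++ p (map (f x) ys) _ ⟩
  count p (map (f x) ys) + count p (cartesianProductWith f xs ys)
    ≡⟨ cong₂ _+_ (count-map p (f x) ys) (count-cartesianProductWith p f xs ys) ⟩
  count (p ∘ f x) ys + sum (map (λ x → count (p ∘ f x) ys) xs) ∎
  where open ≡-Reasoning

length-cartesianProductWith : (f : X → Y → Z) (xs : List X) (ys : List Y) →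
  length (cartesianProductWith f xs ys) ≡ length xs * length ys
length-cartesianProductWith f []       ys = refl
length-cartesianProductWith f (x ∷ xs) ys = begin
  length (map (f x) ys ++ cartesianProductWith f xs ys)        ≡⟨ Listₚ.length-++ (map (f x) ys) ⟩
  length (map (f x) ys) + length (cartesianProductWith f xs ys) ≡⟨ cong₂ _+_ (Listₚ.length-map (f x) ys) (length-cartesianProductWith f xs ys) ⟩
  length ys + length xs * length ys                           ∎
  where open ≡-Reasoning

concatMap-map≡cartesianProductWith : (f : X → Y → Z) (xs : List X) (ys : List Y) →
  concatMap (λ x → map (f x) ys) xs ≡ cartesianProductWith f xs ys
concatMap-map≡cartesianProductWith f []       ys = refl
concatMap-map≡cartesianProductWith f (x ∷ xs) ys = cong (map (f x) ys ++_) (concatMap-map≡cartesianProductWith f xs ys)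

count-↭ : (p : X → Bool) {xs ys : List X} → xs ↭ ys → count p xs ≡ count p ys
count-↭ p xs↭ys = ↭-length (filter-↭ (T? ∘ p) xs↭ys)

count-+ : {p q r s : X → Bool} (xs : List X) →
  (∀ {x} → x ∈ xs → indicator (p x) + indicator (q x) ≡ indicator (r x) + indicator (s x)) →
  count p xs + count q xs ≡ count r xs + count s xs
count-+ [] split = refl
count-+ {p = p} {q} {r} {s} (x ∷ xs) split = begin
  count p (x ∷ xs) + count q (x ∷ xs)
    ≡⟨ cong₂ _+_ (count-∷ p x xs) (count-∷ q x xs) ⟩
  (indicator (p x) + count p xs) + (indicator (q x) + count q xs)
    ≡⟨ +-interchange (indicator (p x)) (count p xs) (indicator (q x)) (count q xs) ⟩
  (indicator (p x) + indicator (q x)) + (count p xs + count q xs)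
    ≡⟨ cong₂ _+_ (split (here refl)) (count-+ xs (split ∘ there)) ⟩
  (indicator (r x) + indicator (s x)) + (count r xs + count s xs)
    ≡⟨ +-interchange (indicator (r x)) (indicator (s x)) (count r xs) (count s xs) ⟩
  (indicator (r x) + count r xs) + (indicator (s x) + count s xs)
    ≡⟨ cong₂ _+_ (count-∷ r x xs) (count-∷ s x xs) ⟨
  count r (x ∷ xs) + count s (x ∷ xs) ∎
  where open ≡-Reasoning

count-split : {p q r : X → Bool} (xs : List X) →
  (∀ {x} → x ∈ xs → indicator (p x) ≡ indicator (q x) + indicator (r x)) →
  count p xs ≡ count q xs + count r xs
count-split {p = p} {q} {r} xs split = begin
  count p xs                                   ≡⟨ +-identityʳ _ ⟨
  count p xs + 0                               ≡⟨ cong (count p xs +_) (count-false xs) ⟨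
  count p xs + count (λ _ → false) xs          ≡⟨ count-+ xs (λ x∈xs → trans (+-identityʳ _) (split x∈xs)) ⟩
  count q xs + count r xs                      ∎
  where open ≡-Reasoning

count-not : (p : X → Bool) (xs : List X) → count (not ∘ p) xs + count p xs ≡ length xs
count-not p xs = begin
  count (not ∘ p) xs + count p xs  ≡⟨ count-split xs (λ {x} _ → split (p x)) ⟨
  count (λ _ → true) xs            ≡⟨ count-true xs ⟩
  length xs                        ∎
  where
  open ≡-Reasoning
  split : ∀ b → 1 ≡ indicator (not b) + indicator b
  split true  = refl
  split false = refl

sum-indicator : (p : X → Bool) (c : ℕ) (xs : List X) → sum (map (λ x → indicator (p x) * c) xs) ≡ count p xs * c
sum-indicator p c []       = refl
sum-indicator p c (x ∷ xs) = begin
  indicator (p x) * c + sum (map (λ x → indicator (p x) * c) xs) ≡⟨ cong (indicator (p x) * c +_) (sum-indicator p c xs) ⟩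
  indicator (p x) * c + count p xs * c                          ≡⟨ *-distribʳ-+ c (indicator (p x)) (count p xs) ⟨
  (indicator (p x) + count p xs) * c                            ≡⟨ cong (_* c) (count-∷ p x xs) ⟨
  count p (x ∷ xs) * c                                          ∎
  where open ≡-Reasoning

indicator-<ᵇ-suc : ∀ a N → indicator (a <ᵇ suc N) ≡ indicator (a <ᵇ N) + indicator (a ≡ᵇ N)
indicator-<ᵇ-suc zero    zero    = refl
indicator-<ᵇ-suc zero    (suc N) = refl
indicator-<ᵇ-suc (suc a) zero    = refl
indicator-<ᵇ-suc (suc a) (suc N) = indicator-<ᵇ-suc a N

sum-count-≡ᵇ : (d : X → ℕ) (xs : List X) → ∀ N →
  sum (map (λ k → count (λ x → d x ≡ᵇ k) xs) (upTo N)) ≡ count (λ x → d x <ᵇ N) xs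
sum-count-≡ᵇ d xs zero    = sym (count-false xs)
sum-count-≡ᵇ d xs (suc N) = begin
  sum (map c (upTo (suc N)))                               ≡⟨ cong (sum ∘ map c) (Listₚ.upTo-∷ʳ N) ⟨
  sum (map c (upTo N ++ N ∷ []))                           ≡⟨ cong sum (Listₚ.map-++ c (upTo N) (N ∷ [])) ⟩
  sum (map c (upTo N) ++ c N ∷ [])                         ≡⟨ sum-++ (map c (upTo N)) (c N ∷ []) ⟩
  sum (map c (upTo N)) + (c N + 0)                         ≡⟨ cong₂ _+_ (sum-count-≡ᵇ d xs N) (+-identityʳ (c N)) ⟩
  count (λ x → d x <ᵇ N) xs + c N                          ≡⟨ count-split xs (λ {x} _ → indicator-<ᵇ-suc (d x) N) ⟨
  count (λ x → d x <ᵇ suc N) xs                            ∎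
  where
  open ≡-Reasoning
  c : ℕ → ℕ
  c k = count (λ x → d x ≡ᵇ k) xs

record IsListing (xs : List X) : Set where
  field
    unique   : Unique xs
    complete : ∀ x → x ∈ xs
open IsListing

listing-↭ : {xs ys : List X} → IsListing xs → IsListing ys → xs ↭ ys
listing-↭ xs! ys! = ∼bag⇒↭ (unique∧set⇒bag (unique xs!) (unique ys!)
  (mk⇔ (λ _ → complete ys! _) (λ _ → complete xs! _)))

map-listing : (g h : X → X) → (∀ x → g (h x) ≡ x) → (∀ x → h (g x) ≡ x) →
  {xs : List X} → IsListing xs → IsListing (map g xs)
map-listing g h gh hg xs! = record
  { unique   = Uniqueₚ.map⁺ (λ {x} {y} gx≡gy → trans (sym (hg x)) (trans (cong h gx≡gy) (hg y))) (unique xs!)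
  ; complete = λ x → subst (_∈ _) (gh x) (∈-map⁺ g (complete xs! (h x)))
  }

count-bijection : (p : X → Bool) (g h : X → X) → (∀ x → g (h x) ≡ x) → (∀ x → h (g x) ≡ x) →
  {xs : List X} → IsListing xs → count (p ∘ g) xs ≡ count p xs
count-bijection p g h gh hg {xs} xs! = begin
  count (p ∘ g) xs   ≡⟨ count-map p g xs ⟨
  count p (map g xs) ≡⟨ count-↭ p (listing-↭ (map-listing g h gh hg xs!) xs!) ⟩
  count p xs         ∎
  where open ≡-Reasoning

cartesianProductWith-listing : (f : X → Y → Z) →
  (∀ {x x′ y y′} → f x y ≡ f x′ y′ → x ≡ x′ × y ≡ y′) → (∀ z → ∃₂ λ x y → f x y ≡ z) →
  {xs : List X} {ys : List Y} → IsListing xs → IsListing ys → IsListing (cartesianProductWith f xs ys)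
cartesianProductWith-listing f f-injective f-surjective xs! ys! = record
  { unique   = Uniqueₚ.cartesianProductWith⁺ f f-injective (unique xs!) (unique ys!)
  ; complete = λ z → let x , y , fxy≡z = f-surjective z in
      subst (_∈ _) fxy≡z (∈-cartesianProductWith⁺ f (complete xs! x) (complete ys! y))
  }

length-allFin : ∀ n → length (allFin n) ≡ n
length-allFin n = Listₚ.length-tabulate id

allFin-listing : IsListing (allFin n)
allFin-listing {n} = record { unique = Uniqueₚ.allFin⁺ n ; complete = ∈-allFin }

count-singleton : (p : X → Bool) {a : X} {xs : List X} → Unique xs → a ∈ xs →
  (∀ x → x ≢ a → p x ≡ false) → count p xs ≡ indicator (p a)
count-singleton p {a} {x ∷ xs} (x∉xs ∷ xs!) (here refl) only-a = begin
  count p (x ∷ xs)              ≡⟨ count-∷ p x xs ⟩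
  indicator (p x) + count p xs  ≡⟨ cong (indicator (p x) +_) (count-none (All.map (only-a _ ∘ ≢-sym) x∉xs)) ⟩
  indicator (p x) + 0           ≡⟨ +-identityʳ _ ⟩
  indicator (p x)               ∎
  where open ≡-Reasoning
count-singleton p {a} {x ∷ xs} (x∉xs ∷ xs!) (there a∈xs) only-a = begin
  count p (x ∷ xs)              ≡⟨ count-∷ p x xs ⟩
  indicator (p x) + count p xs  ≡⟨ cong₂ _+_ (cong indicator (only-a x (All.lookup x∉xs a∈xs))) (count-singleton p xs! a∈xs only-a) ⟩
  indicator (p a)               ∎
  where open ≡-Reasoning

-- Injective words and bijections

T-injective : {a b : Bool} → (T a ⇔ T b) → a ≡ b
T-injective {false} {false} a⇔b = refl
T-injective {false} {true}  a⇔b = ⊥-elim (Equivalence.from a⇔b tt)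
T-injective {true}  {false} a⇔b = ⊥-elim (Equivalence.to a⇔b tt)
T-injective {true}  {true}  a⇔b = refl

T-and : (bs : List Bool) → T (and bs) ⇔ All T bs
T-and []       = mk⇔ (λ _ → []) (λ _ → tt)
T-and (b ∷ bs) = mk⇔
  (λ t → let tb , tbs = Equivalence.to T-∧ t in tb ∷ Equivalence.to (T-and bs) tbs)
  (λ { (tb ∷ tbs) → Equivalence.from T-∧ (tb , Equivalence.from (T-and bs) tbs) })

All-allFin : {P : Fin n → Set} → All P (allFin n) ⇔ (∀ i → P i)
All-allFin = mk⇔ (λ all i → All.lookup all (∈-allFin i)) (λ all → All.tabulate (λ {i} _ → all i))

==ᶠ≡does-≟ : (i j : Fin n) → (i ==ᶠ j) ≡ does (i ≟ j)
==ᶠ≡does-≟ i j with i ≟ j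
... | yes refl = T-injective (mk⇔ (λ _ → tt) (λ _ → ≡⇒≡ᵇ (toℕ i) (toℕ i) refl))
... | no  i≢j  = T-injective (mk⇔ (λ t → i≢j (Finₚ.toℕ-injective (≡ᵇ⇒≡ (toℕ i) (toℕ j) t))) λ ())

T-and-allFin² : (e : Fin n → Fin n → Bool) →
  T (and (concatMap (λ i → map (e i) (allFin n)) (allFin n))) ⇔ (∀ i j → T (e i j))
T-and-allFin² e = mk⇔
  (λ t i → Equivalence.to All-allFin (Allₚ.map⁻ (Equivalence.to All-allFin
    (Allₚ.map⁻ (Allₚ.concat⁻ (Equivalence.to (T-and _) t))) i)))
  (λ t → Equivalence.from (T-and _) (Allₚ.concat⁺ (Allₚ.map⁺ (Equivalence.from All-allFin λ i →
    Allₚ.map⁺ (Equivalence.from All-allFin (t i))))))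

T-isInjective : (f : Fin n → Fin n) → T (isInjective f) ⇔ Injective _≡_ _≡_ f
T-isInjective f = mk⇔
  (λ t {i} {j} → Equivalence.to (T-entry i j) (Equivalence.to (T-and-allFin² _) t i j))
  (λ f-inj → Equivalence.from (T-and-allFin² _) λ i j → Equivalence.from (T-entry i j) f-inj)
  where
  T-entry : ∀ i j → T (if i ==ᶠ j then true else not (f i ==ᶠ f j)) ⇔ (f i ≡ f j → i ≡ j)
  T-entry i j rewrite ==ᶠ≡does-≟ i j | ==ᶠ≡does-≟ (f i) (f j) with i ≟ j | f i ≟ f j
  ... | yes i≡j | _         = mk⇔ (λ _ _ → i≡j) (λ _ → tt)
  ... | no  i≢j | yes fi≡fj = mk⇔ (λ ()) (λ inj → i≢j (inj fi≡fj))
  ... | no  _   | no  fi≢fj = mk⇔ (λ _ fi≡fj → ⊥-elim (fi≢fj fi≡fj)) (λ _ → tt)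

_∈ᵇ_ : Fin n → Vec (Fin n) m → Bool
i ∈ᵇ []      = false
i ∈ᵇ (x ∷ w) = does (i ≟ x) ∨ i ∈ᵇ w

distinct : Vec (Fin n) m → Bool
distinct []      = true
distinct (x ∷ w) = not (x ∈ᵇ w) ∧ distinct w

lookup∈ᵇ : (w : Vec (Fin n) m) (k : Fin m) → T (lookup w k ∈ᵇ w)
lookup∈ᵇ (x ∷ w) Fin.zero    rewrite dec-true (x ≟ x) refl = tt
lookup∈ᵇ (x ∷ w) (Fin.suc k) = Equivalence.from T-∨ (inj₂ (lookup∈ᵇ w k))

∈ᵇ⇒lookup : (i : Fin n) (w : Vec (Fin n) m) → T (i ∈ᵇ w) → ∃ λ k → lookup w k ≡ i
∈ᵇ⇒lookup i (x ∷ w) t with i ≟ x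
... | yes refl = Fin.zero , refl
... | no  _    = let k , wk≡i = ∈ᵇ⇒lookup i w t in Fin.suc k , wk≡i

T-distinct : (v : Vec (Fin n) m) → T (distinct v) ⇔ Injective _≡_ _≡_ (lookup v)
T-distinct v = mk⇔ (distinct⇒injective v) (injective⇒distinct v)
  where
  head∉tail : (x : Fin n) (w : Vec (Fin n) m) → T (distinct (x ∷ w)) → ¬ T (x ∈ᵇ w)
  head∉tail x w t with x ∈ᵇ w
  head∉tail x w () | true
  T-not : {b : Bool} → ¬ T b → T (not b)
  T-not {false} _  = tt
  T-not {true}  ¬t = ¬t tt
  distinct⇒injective : (v : Vec (Fin n) m) → T (distinct v) → Injective _≡_ _≡_ (lookup v)
  distinct⇒injective (x ∷ w) t {Fin.zero}  {Fin.zero}  _  = refl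
  distinct⇒injective (x ∷ w) t {Fin.zero}  {Fin.suc j} eq = ⊥-elim (head∉tail x w t (subst (λ y → T (y ∈ᵇ w)) (sym eq) (lookup∈ᵇ w j)))
  distinct⇒injective (x ∷ w) t {Fin.suc i} {Fin.zero}  eq = ⊥-elim (head∉tail x w t (subst (λ y → T (y ∈ᵇ w)) eq (lookup∈ᵇ w i)))
  distinct⇒injective (x ∷ w) t {Fin.suc i} {Fin.suc j} eq =
    cong Fin.suc (distinct⇒injective w (proj₂ (Equivalence.to T-∧ t)) eq)
  injective⇒distinct : (v : Vec (Fin n) m) → Injective _≡_ _≡_ (lookup v) → T (distinct v)
  injective⇒distinct []      _   = tt
  injective⇒distinct (x ∷ w) inj = Equivalence.from T-∧ (T-not x∉ᵇw , injective⇒distinct w (Finₚ.suc-injective ∘ inj))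
    where
    x∉ᵇw : ¬ T (x ∈ᵇ w)
    x∉ᵇw t with k , wk≡x ← ∈ᵇ⇒lookup x w t with () ← inj {Fin.suc k} {Fin.zero} wk≡x

count-∈ᵇ : (w : Vec (Fin n) m) → T (distinct w) → count (_∈ᵇ w) (allFin n) ≡ m
count-∈ᵇ {n} []      _ = count-false (allFin n)
count-∈ᵇ {n} {suc m} (x ∷ w) t = begin
  count (_∈ᵇ (x ∷ w)) (allFin n)
    ≡⟨ count-split (allFin n) (λ {i} _ → split i) ⟩
  count (λ i → does (i ≟ x)) (allFin n) + count (_∈ᵇ w) (allFin n)
    ≡⟨ cong₂ _+_ (count-singleton _ (unique allFin-listing) (∈-allFin x) (λ i i≢x → dec-false (i ≟ x) i≢x)) (count-∈ᵇ w w!) ⟩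
  indicator (does (x ≟ x)) + m
    ≡⟨ cong (λ b → indicator b + m) (dec-true (x ≟ x) refl) ⟩
  suc m ∎
  where
  open ≡-Reasoning
  x∉w : (x ∈ᵇ w) ≡ false
  x∉w = Equivalence.to T-not-≡ (proj₁ (Equivalence.to T-∧ t))
  w! : T (distinct w)
  w! = proj₂ (Equivalence.to T-∧ t)
  split : ∀ i → indicator (does (i ≟ x) ∨ i ∈ᵇ w) ≡ indicator (does (i ≟ x)) + indicator (i ∈ᵇ w)
  split i with i ≟ x
  ... | yes refl rewrite x∉w = refl
  ... | no  _    = refl

count-∉ᵇ : (w : Vec (Fin n) m) → T (distinct w) → count (λ i → not (i ∈ᵇ w)) (allFin n) ≡ n ∸ m
count-∉ᵇ {n} {m} w t = begin
  count∉ w                             ≡⟨ m+n∸n≡m (count∉ w) m ⟨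
  count∉ w + m ∸ m                     ≡⟨ cong (λ k → count∉ w + k ∸ m) (count-∈ᵇ w t) ⟨
  count∉ w + count (_∈ᵇ w) (allFin n) ∸ m ≡⟨ cong (_∸ m) (trans (count-not (_∈ᵇ w) (allFin n)) (length-allFin n)) ⟩
  n ∸ m                                ∎
  where
  open ≡-Reasoning
  count∉ : Vec (Fin n) m → ℕ
  count∉ w = count (λ i → not (i ∈ᵇ w)) (allFin n)

allVecs-listing : IsListing (allVecs n m)
allVecs-listing {n} {zero}  = record { unique = [] ∷ [] ; complete = λ { [] → here refl } }
allVecs-listing {n} {suc m} =
  subst IsListing (sym (concatMap-map≡cartesianProductWith _∷_ (allFin n) (allVecs n m)))
    (cartesianProductWith-listing _∷_ Vecₚ.∷-injective (λ { (x ∷ w) → x , w , refl }) allFin-listing allVecs-listing)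

count-distinct : ∀ n m → count distinct (allVecs n m) ≡ n P′ m
count-distinct n zero    = refl
count-distinct n (suc m) = begin
  count distinct (allVecs n (suc m))
    ≡⟨ count-↭ distinct (listing-↭ allVecs-listing extend-listing) ⟩
  count distinct (cartesianProductWith extend (allVecs n m) (allFin n))
    ≡⟨ count-cartesianProductWith distinct extend (allVecs n m) (allFin n) ⟩
  sum (map (λ w → count (distinct ∘ extend w) (allFin n)) (allVecs n m))
    ≡⟨ cong sum (Listₚ.map-cong count-extensions (allVecs n m)) ⟩
  sum (map (λ w → indicator (distinct w) * (n ∸ m)) (allVecs n m))
    ≡⟨ sum-indicator distinct (n ∸ m) (allVecs n m) ⟩
  count distinct (allVecs n m) * (n ∸ m)
    ≡⟨ cong (_* (n ∸ m)) (count-distinct n m) ⟩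
  (n P′ m) * (n ∸ m)
    ≡⟨ *-comm (n P′ m) (n ∸ m) ⟩
  n P′ suc m ∎
  where
  open ≡-Reasoning
  extend : Vec (Fin n) m → Fin n → Vec (Fin n) (suc m)
  extend w i = i ∷ w
  extend-listing : IsListing (cartesianProductWith extend (allVecs n m) (allFin n))
  extend-listing = cartesianProductWith-listing extend (λ eq → let i≡j , w≡v = Vecₚ.∷-injective eq in w≡v , i≡j)
    (λ { (x ∷ w) → w , x , refl }) allVecs-listing allFin-listing
  count-extensions : ∀ w → count (distinct ∘ extend w) (allFin n) ≡ indicator (distinct w) * (n ∸ m)
  count-extensions w with distinct w in eq
  ... | true  = trans (count-cong (allFin n) (λ i → ∧-identityʳ _)) (trans (count-∉ᵇ w (Equivalence.from T-≡ eq)) (sym (+-identityʳ _)))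
  ... | false = trans (count-cong (allFin n) (λ i → ∧-zeroʳ _)) (count-false (allFin n))

nP′n≡n! : ∀ n → n P′ n ≡ n !
nP′n≡n! n = trans (cong (if_then n P′ n else 0) (sym (Equivalence.to T-≡ (≤⇒≤ᵇ (≤-refl {n}))))) (nPn≡n! n)

injective-cong : {f g : X → Y} → (∀ x → f x ≡ g x) → Injective _≡_ _≡_ f → Injective _≡_ _≡_ g
injective-cong f≗g f-inj {x} {y} gx≡gy = f-inj (trans (f≗g x) (trans gx≡gy (sym (f≗g y))))

injective-∘-permutation : (f : Fin n → X) (π : Permutation′ n) →
  Injective _≡_ _≡_ f ⇔ Injective _≡_ _≡_ (f ∘ (π ⟨$⟩ʳ_))
injective-∘-permutation f π = mk⇔
  (λ f-inj {x} {y} πx≡πy → trans (sym (inverseˡ π)) (trans (cong (π ⟨$⟩ˡ_) (f-inj πx≡πy)) (inverseˡ π)))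
  (λ fπ-inj {x} {y} fx≡fy → trans (sym (inverseʳ π)) (trans (cong (π ⟨$⟩ʳ_) (fπ-inj
    (trans (cong f (inverseʳ π)) (trans fx≡fy (sym (cong f (inverseʳ π))))))) (inverseʳ π)))

isInjective∘lookup≡distinct : (v : Vec (Fin n) n) → isInjective (lookup v) ≡ distinct v
isInjective∘lookup≡distinct v = T-injective (mk⇔
  (Equivalence.from (T-distinct v) ∘ Equivalence.to (T-isInjective (lookup v)))
  (Equivalence.from (T-isInjective (lookup v)) ∘ Equivalence.to (T-distinct v)))

count-allBijections : (p : (Fin n → Fin n) → Bool) →
  count p (allBijections n) ≡ count (λ v → distinct v ∧ p (lookup v)) (allVecs n n)
count-allBijections {n} p = begin
  count p (allBijections n)                                         ≡⟨ count-filter isInjective p (map lookup (allVecs n n)) ⟩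
  count (λ σ → isInjective σ ∧ p σ) (map lookup (allVecs n n))      ≡⟨ count-map _ lookup (allVecs n n) ⟩
  count (λ v → isInjective (lookup v) ∧ p (lookup v)) (allVecs n n)
    ≡⟨ count-cong (allVecs n n) (λ v → cong (_∧ p (lookup v)) (isInjective∘lookup≡distinct v)) ⟩
  count (λ v → distinct v ∧ p (lookup v)) (allVecs n n)             ∎
  where open ≡-Reasoning

length-allBijections : ∀ n → length (allBijections n) ≡ n !
length-allBijections n = begin
  length (allBijections n)                      ≡⟨ count-true (allBijections n) ⟨
  count (λ _ → true) (allBijections n)          ≡⟨ count-allBijections {n} (λ _ → true) ⟩
  count (λ v → distinct v ∧ true) (allVecs n n) ≡⟨ count-cong (allVecs n n) (λ v → ∧-identityʳ (distinct v)) ⟩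
  count distinct (allVecs n n)                  ≡⟨ count-distinct n n ⟩
  n P′ n                                        ≡⟨ nP′n≡n! n ⟩
  n !                                           ∎
  where open ≡-Reasoning

count-allBijections-∘ : (p : (Fin n → Fin n) → Bool) → (∀ {σ τ} → (∀ x → σ x ≡ τ x) → p σ ≡ p τ) →
  (π : Permutation′ n) → count (λ σ → p (σ ∘ (π ⟨$⟩ʳ_))) (allBijections n) ≡ count p (allBijections n)
count-allBijections-∘ {n} p p-resp π = begin
  count (λ σ → p (σ ∘ (π ⟨$⟩ʳ_))) (allBijections n)
    ≡⟨ count-allBijections (λ σ → p (σ ∘ (π ⟨$⟩ʳ_))) ⟩
  count (λ v → distinct v ∧ p (lookup v ∘ (π ⟨$⟩ʳ_))) (allVecs n n)
    ≡⟨ count-cong (allVecs n n) (λ v → cong₂ _∧_ (sym (distinct-reorder v)) (p-resp (λ i → sym (Vecₚ.lookup∘tabulate _ i)))) ⟩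
  count (q ∘ reorder (π ⟨$⟩ʳ_)) (allVecs n n)
    ≡⟨ count-bijection q (reorder (π ⟨$⟩ʳ_)) (reorder (π ⟨$⟩ˡ_))
         (reorder-inverse (inverseˡ π)) (reorder-inverse (inverseʳ π)) allVecs-listing ⟩
  count q (allVecs n n)
    ≡⟨ count-allBijections p ⟨
  count p (allBijections n) ∎
  where
  open ≡-Reasoning
  q : Vec (Fin n) n → Bool
  q v = distinct v ∧ p (lookup v)
  reorder : (Fin n → Fin n) → Vec (Fin n) n → Vec (Fin n) n
  reorder f v = Vec.tabulate (lookup v ∘ f)
  reorder-inverse : {f g : Fin n → Fin n} → (∀ {i} → g (f i) ≡ i) → ∀ v → reorder f (reorder g v) ≡ v
  reorder-inverse {f} {g} gf v = begin
    Vec.tabulate (lookup (Vec.tabulate (lookup v ∘ g)) ∘ f)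
      ≡⟨ Vecₚ.tabulate-cong (λ i → trans (Vecₚ.lookup∘tabulate _ (f i)) (cong (lookup v) gf)) ⟩
    Vec.tabulate (lookup v)                                  ≡⟨ Vecₚ.tabulate∘lookup v ⟩
    v                                                        ∎
  distinct-reorder : ∀ v → distinct (reorder (π ⟨$⟩ʳ_) v) ≡ distinct v
  distinct-reorder v = T-injective (mk⇔
    (Equivalence.from (T-distinct v) ∘ Equivalence.from (injective-∘-permutation (lookup v) π)
      ∘ injective-cong (Vecₚ.lookup∘tabulate _) ∘ Equivalence.to (T-distinct (reorder (π ⟨$⟩ʳ_) v)))
    (Equivalence.from (T-distinct (reorder (π ⟨$⟩ʳ_) v)) ∘ injective-cong (sym ∘ Vecₚ.lookup∘tabulate _)
      ∘ Equivalence.to (injective-∘-permutation (lookup v) π) ∘ Equivalence.to (T-distinct v)))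

-- Descents

Arcs : ℕ → Set
Arcs n = Fin n → Fin n → Bool

infix 4 _≐_
_≐_ : Arcs n → Arcs n → Set
G ≐ H = ∀ x y → G x y ≡ H x y

noArcs : Arcs n
noArcs _ _ = false

arcPairs : ∀ n → List (Fin n × Fin n)
arcPairs n = concatMap (λ u → map (λ v → (u , v)) (allFin n)) (allFin n)

isDescent : (Fin n → Fin n) → Fin n → Fin n → Bool
isDescent σ u v = toℕ (σ v) <ᵇ toℕ (σ u)

-- Definitionally equal to des D σ when G is arc D.
descents : Arcs n → (Fin n → Fin n) → ℕ
descents {n} G σ = count (λ (u , v) → G u v ∧ isDescent σ u v) (arcPairs n)

arcPairs-listing : IsListing (arcPairs n)
arcPairs-listing {n} = subst IsListing (sym (concatMap-map≡cartesianProductWith _,_ (allFin n) (allFin n)))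
  (cartesianProductWith-listing _,_ (λ { refl → refl , refl }) (λ (x , y) → x , y , refl) allFin-listing allFin-listing)

descents-cong : {G H : Arcs n} {σ τ : Fin n → Fin n} → G ≐ H → (∀ x → σ x ≡ τ x) → descents G σ ≡ descents H τ
descents-cong {n} G≐H σ≗τ = count-cong (arcPairs n) λ (u , v) →
  cong₂ _∧_ (G≐H u v) (cong₂ (λ a b → toℕ a <ᵇ toℕ b) (σ≗τ v) (σ≗τ u))

descents≤ : (G : Arcs n) (σ : Fin n → Fin n) → descents G σ ≤ n * n
descents≤ {n} G σ = ≤-trans (count≤length _ (arcPairs n)) (≤-reflexive (begin
  length (arcPairs n)                             ≡⟨ cong length (concatMap-map≡cartesianProductWith _,_ (allFin n) (allFin n)) ⟩
  length (cartesianProduct (allFin n) (allFin n)) ≡⟨ length-cartesianProductWith _,_ (allFin n) (allFin n) ⟩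
  length (allFin n) * length (allFin n)           ≡⟨ cong₂ _*_ (length-allFin n) (length-allFin n) ⟩
  n * n                                           ∎))
  where open ≡-Reasoning

relabel : Permutation′ n → Arcs n → Arcs n
relabel π G x y = G (π ⟨$⟩ʳ x) (π ⟨$⟩ʳ y)

descents-relabel : (π : Permutation′ n) (G : Arcs n) (σ : Fin n → Fin n) →
  descents (relabel π G) σ ≡ descents G (σ ∘ (π ⟨$⟩ˡ_))
descents-relabel {n} π G σ = begin
  descents (relabel π G) σ
    ≡⟨ count-cong (arcPairs n) (λ (u , v) → cong₂ (λ a b → relabel π G u v ∧ (toℕ (σ a) <ᵇ toℕ (σ b))) (inverseˡ π) (inverseˡ π)) ⟨
  count (p ∘ relabelPair (π ⟨$⟩ʳ_)) (arcPairs n)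
    ≡⟨ count-bijection p (relabelPair (π ⟨$⟩ʳ_)) (relabelPair (π ⟨$⟩ˡ_))
         (λ _ → cong₂ _,_ (inverseʳ π) (inverseʳ π)) (λ _ → cong₂ _,_ (inverseˡ π) (inverseˡ π)) arcPairs-listing ⟩
  descents G (σ ∘ (π ⟨$⟩ˡ_)) ∎
  where
  open ≡-Reasoning
  p : Fin n × Fin n → Bool
  p (u , v) = G u v ∧ isDescent (σ ∘ (π ⟨$⟩ˡ_)) u v
  relabelPair : (Fin n → Fin n) → Fin n × Fin n → Fin n × Fin n
  relabelPair f (u , v) = f u , f v

addArc : Arcs n → Fin n → Fin n → Arcs n
addArc G u v x y = G x y ∨ (does (x ≟ u) ∧ does (y ≟ v))

descents-addArc : (G : Arcs n) {u v : Fin n} → G u v ≡ false → (σ : Fin n → Fin n) →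
  descents (addArc G u v) σ ≡ descents G σ + indicator (isDescent σ u v)
descents-addArc {n} G {u} {v} no-uv σ = begin
  descents (addArc G u v) σ
    ≡⟨ count-split (arcPairs n) (λ {xy} _ → split xy) ⟩
  descents G σ + count new (arcPairs n)
    ≡⟨ cong (descents G σ +_) (count-singleton new (unique arcPairs-listing) (complete arcPairs-listing (u , v)) only-uv) ⟩
  descents G σ + indicator (new (u , v))
    ≡⟨ cong (λ b → descents G σ + indicator (b ∧ isDescent σ u v)) (cong₂ _∧_ (dec-true (u ≟ u) refl) (dec-true (v ≟ v) refl)) ⟩
  descents G σ + indicator (isDescent σ u v) ∎
  where
  open ≡-Reasoning
  new : Fin n × Fin n → Bool
  new (x , y) = (does (x ≟ u) ∧ does (y ≟ v)) ∧ isDescent σ x y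
  only-uv : ∀ xy → xy ≢ (u , v) → new xy ≡ false
  only-uv (x , y) xy≢uv with x ≟ u | y ≟ v
  ... | yes refl | yes refl = ⊥-elim (xy≢uv refl)
  ... | yes _    | no  _    = refl
  ... | no  _    | _        = refl
  split : ∀ ((x , y) : Fin n × Fin n) →
    indicator (addArc G u v x y ∧ isDescent σ x y) ≡ indicator (G x y ∧ isDescent σ x y) + indicator (new (x , y))
  split (x , y) with x ≟ u | y ≟ v
  ... | yes refl | yes refl rewrite no-uv = refl
  ... | yes _    | no  _    rewrite ∨-identityʳ (G x y) = sym (+-identityʳ _)
  ... | no  _    | _        rewrite ∨-identityʳ (G x y) = sym (+-identityʳ _)

descentCount : Arcs n → ℕ → ℕ
descentCount {n} G k = count (λ σ → descents G σ ≡ᵇ k) (allBijections n)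

shift : (ℕ → ℕ) → ℕ → ℕ
shift f zero    = 0
shift f (suc k) = f k

∈-allBijections⇒injective : {σ : Fin n → Fin n} → σ ∈ allBijections n → Injective _≡_ _≡_ σ
∈-allBijections⇒injective {n} {σ} σ∈ =
  Equivalence.to (T-isInjective σ) (proj₂ (∈-filter⁻ (T? ∘ isInjective) {xs = map lookup (allVecs n n)} σ∈))

descentCount-cong : {G H : Arcs n} → G ≐ H → ∀ k → descentCount G k ≡ descentCount H k
descentCount-cong {n} G≐H k = count-cong (allBijections n) (λ σ → cong (_≡ᵇ k) (descents-cong {σ = σ} G≐H (λ _ → refl)))

descentCount-relabel : (π : Permutation′ n) (G : Arcs n) → ∀ k → descentCount (relabel π G) k ≡ descentCount G k
descentCount-relabel {n} π G k = begin
  count (λ σ → descents (relabel π G) σ ≡ᵇ k) (allBijections n)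
    ≡⟨ count-cong (allBijections n) (λ σ → cong (_≡ᵇ k) (descents-relabel π G σ)) ⟩
  count (λ σ → descents G (σ ∘ (π ⟨$⟩ˡ_)) ≡ᵇ k) (allBijections n)
    ≡⟨ count-allBijections-∘ (λ σ → descents G σ ≡ᵇ k) (λ σ≗τ → cong (_≡ᵇ k) (descents-cong (λ _ _ → refl) σ≗τ))
         (Permutation.flip π) ⟩
  count (λ σ → descents G σ ≡ᵇ k) (allBijections n) ∎
  where open ≡-Reasoning

descentCount-empty : ∀ n k → descentCount {n} noArcs k ≡ n ! * (0 C k)
descentCount-empty n k = begin
  count (λ σ → descents noArcs σ ≡ᵇ k) (allBijections n)
    ≡⟨ count-cong (allBijections n) (λ σ → cong (_≡ᵇ k) (count-false (arcPairs n))) ⟩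
  count (λ _ → 0 ≡ᵇ k) (allBijections n)
    ≡⟨ at k ⟩
  n ! * (0 C k) ∎
  where
  open ≡-Reasoning
  at : ∀ k → count (λ _ → 0 ≡ᵇ k) (allBijections n) ≡ n ! * (0 C k)
  at zero    = trans (count-true (allBijections n)) (trans (length-allBijections n) (sym (*-identityʳ (n !))))
  at (suc k) = trans (count-false (allBijections n)) (sym (*-zeroʳ (n !)))

indicator-<ᵇ-swap : {a b : ℕ} → a ≢ b → indicator (a <ᵇ b) + indicator (b <ᵇ a) ≡ 1
indicator-<ᵇ-swap {a} {b} a≢b with a <ᵇ b in a<b | b <ᵇ a in b<a
... | true  | true  = ⊥-elim (<-asym (<ᵇ⇒< a b (Equivalence.from T-≡ a<b)) (<ᵇ⇒< b a (Equivalence.from T-≡ b<a)))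
... | true  | false = refl
... | false | true  = refl
... | false | false with <-cmp a b
...   | tri< a<b′ _ _ = ⊥-elim (subst T a<b (<⇒<ᵇ a<b′))
...   | tri≈ _ a≡b _ = ⊥-elim (a≢b a≡b)
...   | tri> _ _ b<a′ = ⊥-elim (subst T b<a (<⇒<ᵇ b<a′))

indicator-≡ᵇ-orientations : (d k : ℕ) {a b : Bool} → indicator a + indicator b ≡ 1 →
  indicator (d + indicator a ≡ᵇ k) + indicator (d + indicator b ≡ᵇ k) ≡ indicator (d ≡ᵇ k) + indicator (suc d ≡ᵇ k)
indicator-≡ᵇ-orientations d k {true}  {true}  ()
indicator-≡ᵇ-orientations d k {true}  {false} _ rewrite +-comm d 1 | +-identityʳ d = +-comm (indicator (suc d ≡ᵇ k)) _
indicator-≡ᵇ-orientations d k {false} {true}  _ rewrite +-comm d 1 | +-identityʳ d = refl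
indicator-≡ᵇ-orientations d k {false} {false} ()

-- For an injective σ exactly one of the two orientations of the new arc is a descent.
descentCount-addArc-both : (G : Arcs n) {u v : Fin n} → u ≢ v → G u v ≡ false → G v u ≡ false → ∀ k →
  descentCount (addArc G u v) k + descentCount (addArc G v u) k ≡ descentCount G k + shift (descentCount G) k
descentCount-addArc-both {n} G {u} {v} u≢v no-uv no-vu k = begin
  descentCount (addArc G u v) k + descentCount (addArc G v u) k
    ≡⟨ count-+ (allBijections n) orientations ⟩
  descentCount G k + count (λ σ → suc (descents G σ) ≡ᵇ k) (allBijections n)
    ≡⟨ cong (descentCount G k +_) (shifted k) ⟩
  descentCount G k + shift (descentCount G) k ∎
  where
  open ≡-Reasoning
  orientations : ∀ {σ} → σ ∈ allBijections n →
    indicator (descents (addArc G u v) σ ≡ᵇ k) + indicator (descents (addArc G v u) σ ≡ᵇ k)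
      ≡ indicator (descents G σ ≡ᵇ k) + indicator (suc (descents G σ) ≡ᵇ k)
  orientations {σ} σ∈ rewrite descents-addArc G no-uv σ | descents-addArc G no-vu σ =
    indicator-≡ᵇ-orientations (descents G σ) k
      (indicator-<ᵇ-swap (u≢v ∘ ∈-allBijections⇒injective σ∈ ∘ Finₚ.toℕ-injective ∘ sym))
  shifted : ∀ k → count (λ σ → suc (descents G σ) ≡ᵇ k) (allBijections n) ≡ shift (descentCount G) k
  shifted zero    = count-false (allBijections n)
  shifted (suc k) = refl

-- Symmetric arc insertions

record Exchangeable (H : Arcs n) (u v : Fin n) : Set where
  field
    automorphism : Permutation′ n
    preserves    : relabel automorphism H ≐ H
    sends-u      : automorphism ⟨$⟩ʳ u ≡ v
    sends-v      : automorphism ⟨$⟩ʳ v ≡ u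
    u≢v          : u ≢ v
    no-uv        : H u v ≡ false
    no-vu        : H v u ≡ false

does-≟-permutation : (π : Permutation′ n) {a b : Fin n} → π ⟨$⟩ʳ b ≡ a → ∀ x → does (π ⟨$⟩ʳ x ≟ a) ≡ does (x ≟ b)
does-≟-permutation π {a} {b} πb≡a x with x ≟ b
... | yes refl = dec-true (π ⟨$⟩ʳ x ≟ a) πb≡a
... | no  x≢b  = dec-false (π ⟨$⟩ʳ x ≟ a) λ πx≡a →
  x≢b (trans (sym (inverseˡ π)) (trans (cong (π ⟨$⟩ˡ_) (trans πx≡a (sym πb≡a))) (inverseˡ π)))

relabel-addArc : {H : Arcs n} {u v : Fin n} (ex : Exchangeable H u v) →
  relabel (Exchangeable.automorphism ex) (addArc H u v) ≐ addArc H v u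
relabel-addArc {H = H} {u} {v} ex x y = cong₂ _∨_ (preserves x y)
  (cong₂ _∧_ (does-≟-permutation automorphism sends-v x) (does-≟-permutation automorphism sends-u y))
  where open Exchangeable ex

descentCount-addArc : {H : Arcs n} {u v : Fin n} → Exchangeable H u v → ∀ k →
  2 * descentCount (addArc H u v) k ≡ descentCount H k + shift (descentCount H) k
descentCount-addArc {H = H} {u} {v} ex k = begin
  2 * descentCount (addArc H u v) k
    ≡⟨ cong (descentCount (addArc H u v) k +_) (+-identityʳ _) ⟩
  descentCount (addArc H u v) k + descentCount (addArc H u v) k
    ≡⟨ cong (descentCount (addArc H u v) k +_)
         (trans (sym (descentCount-cong (relabel-addArc ex) k)) (descentCount-relabel automorphism (addArc H u v) k)) ⟨
  descentCount (addArc H u v) k + descentCount (addArc H v u) k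
    ≡⟨ descentCount-addArc-both H u≢v no-uv no-vu k ⟩
  descentCount H k + shift (descentCount H) k ∎
  where
  open ≡-Reasoning
  open Exchangeable ex

-- Arc relations are functions, so equal digraphs are only pointwise equal (_≐_); reshape transports along that.
data Derivation {n} (G₀ : Arcs n) : Arcs n → ℕ → Set where
  []      : Derivation G₀ G₀ 0
  _▷_     : ∀ {H m u v} → Derivation G₀ H m → Exchangeable H u v → Derivation G₀ (addArc H u v) (suc m)
  reshape : ∀ {G G′ m} → Derivation G₀ G m → G ≐ G′ → Derivation G₀ G′ m

pascal-shift : ∀ m k → m C k + shift (m C_) k ≡ suc m C k
pascal-shift m zero    = refl
pascal-shift m (suc k) = trans (+-comm (m C suc k) (m C k)) (nCk+nC[k+1]≡[n+1]C[k+1] m k)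

binomial-descents : {G : Arcs n} → Derivation noArcs G m → ∀ k → 2 ^ m * descentCount G k ≡ n ! * (m C k)
binomial-descents {n} [] k = trans (+-identityʳ _) (descentCount-empty n k)
binomial-descents {n} {suc m} (_▷_ {H} {u = u} {v} d ex) k = begin
  2 ^ suc m * descentCount (addArc H u v) k
    ≡⟨ trans (cong (_* descentCount (addArc H u v) k) (*-comm 2 (2 ^ m))) (*-assoc (2 ^ m) 2 _) ⟩
  2 ^ m * (2 * descentCount (addArc H u v) k)
    ≡⟨ cong (2 ^ m *_) (descentCount-addArc ex k) ⟩
  2 ^ m * (descentCount H k + shift (descentCount H) k)
    ≡⟨ *-distribˡ-+ (2 ^ m) _ _ ⟩
  2 ^ m * descentCount H k + 2 ^ m * shift (descentCount H) k
    ≡⟨ cong₂ _+_ (binomial-descents d k) (shifted k) ⟩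
  n ! * (m C k) + n ! * shift (m C_) k
    ≡⟨ *-distribˡ-+ (n !) _ _ ⟨
  n ! * (m C k + shift (m C_) k)
    ≡⟨ cong (n ! *_) (pascal-shift m k) ⟩
  n ! * (suc m C k) ∎
  where
  open ≡-Reasoning
  shifted : ∀ k → 2 ^ m * shift (descentCount H) k ≡ n ! * shift (m C_) k
  shifted zero    = trans (*-zeroʳ (2 ^ m)) (sym (*-zeroʳ (n !)))
  shifted (suc k) = binomial-descents d k
binomial-descents {m = m} (reshape d G≐G′) k = trans (cong (2 ^ m *_) (sym (descentCount-cong G≐G′ k))) (binomial-descents d k)

Loopless : Arcs n → Set
Loopless G = ∀ x → G x x ≡ false

derivation-loopless : {G₀ G : Arcs n} → Loopless G₀ → Derivation G₀ G m → Loopless G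
derivation-loopless G₀-loopless [] = G₀-loopless
derivation-loopless G₀-loopless (_▷_ {H} {u = u} {v} d ex) x with x ≟ u | x ≟ v
... | yes refl | yes refl = ⊥-elim (Exchangeable.u≢v ex refl)
... | yes _    | no  _    = trans (∨-identityʳ (H x x)) (derivation-loopless G₀-loopless d x)
... | no  _    | _        = trans (∨-identityʳ (H x x)) (derivation-loopless G₀-loopless d x)
derivation-loopless G₀-loopless (reshape d G≐G′) x = trans (sym (G≐G′ x x)) (derivation-loopless G₀-loopless d x)

_++ᵈ_ : {G₀ G₁ G₂ : Arcs n} {m₁ m₂ : ℕ} → Derivation G₀ G₁ m₁ → Derivation G₁ G₂ m₂ → Derivation G₀ G₂ (m₂ + m₁)
d₁ ++ᵈ []             = d₁
d₁ ++ᵈ (d₂ ▷ ex)      = (d₁ ++ᵈ d₂) ▷ ex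
d₁ ++ᵈ reshape d₂ G≐G′ = reshape (d₁ ++ᵈ d₂) G≐G′

reshape-source : {G₀ G₀′ G : Arcs n} → G₀ ≐ G₀′ → Derivation G₀ G m → Derivation G₀′ G m
reshape-source G₀≐G₀′ []               = reshape [] (λ x y → sym (G₀≐G₀′ x y))
reshape-source G₀≐G₀′ (d ▷ ex)         = reshape-source G₀≐G₀′ d ▷ ex
reshape-source G₀≐G₀′ (reshape d G≐G′) = reshape (reshape-source G₀≐G₀′ d) G≐G′

-- Embeddings, disjoint unions and binomial forests

record Embedding (n N : ℕ) : Set where
  field
    to      : Fin n → Fin N
    from    : Fin N → Maybe (Fin n)
    from-to : ∀ x → from (to x) ≡ just x
    to-from : ∀ {y x} → from y ≡ just x → to x ≡ y

module Extension {n N : ℕ} (E : Embedding n N) where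
  open Embedding E

  extendAt : Arcs n → Arcs N → Maybe (Fin n) → Maybe (Fin n) → Fin N → Fin N → Bool
  extendAt G K (just x) (just x′) _ _ = G x x′
  extendAt G K nothing  nothing   y z = K y z
  extendAt G K (just _) nothing   _ _ = false
  extendAt G K nothing  (just _)  _ _ = false

  -- G on the image of the embedding, K off it, and no arcs in between.
  extend : Arcs n → Arcs N → Arcs N
  extend G K y z = extendAt G K (from y) (from z) y z

  extend-to : (G : Arcs n) (K : Arcs N) (x x′ : Fin n) → extend G K (to x) (to x′) ≡ G x x′
  extend-to G K x x′ rewrite from-to x | from-to x′ = refl

  extend-cong : {G G′ : Arcs n} (K : Arcs N) → G ≐ G′ → extend G K ≐ extend G′ K
  extend-cong K G≐G′ y z with from y | from z
  ... | just x  | just x′ = G≐G′ x x′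
  ... | just _  | nothing = refl
  ... | nothing | just _  = refl
  ... | nothing | nothing = refl

  extendFun : (Fin n → Fin n) → Fin N → Fin N
  extendFun f y = Maybe.maybe (to ∘ f) y (from y)

  from-extendFun : (f : Fin n → Fin n) (y : Fin N) → from (extendFun f y) ≡ Maybe.map f (from y)
  from-extendFun f y with from y in from-y
  ... | just x  = from-to (f x)
  ... | nothing = from-y

  extendFun-inverse : {f g : Fin n → Fin n} → (∀ x → f (g x) ≡ x) → ∀ y → extendFun f (extendFun g y) ≡ y
  extendFun-inverse {f} {g} fg y rewrite from-extendFun g y with from y in from-y
  ... | just x  = trans (cong to (fg x)) (to-from from-y)
  ... | nothing = refl

  extendPermutation : Permutation′ n → Permutation′ N
  extendPermutation π = Permutation.permutation (extendFun (π ⟨$⟩ʳ_)) (extendFun (π ⟨$⟩ˡ_))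
    (extendFun-inverse (λ _ → inverseʳ π)) (extendFun-inverse (λ _ → inverseˡ π))

  isAt : Maybe (Fin n) → Fin n → Bool
  isAt (just x) u = does (x ≟ u)
  isAt nothing  u = false

  does-≟-to : (y : Fin N) (u : Fin n) → does (y ≟ to u) ≡ isAt (from y) u
  does-≟-to y u with y ≟ to u
  ... | yes refl rewrite from-to u = sym (dec-true (u ≟ u) refl)
  ... | no y≢u with from y in from-y
  ...   | nothing = refl
  ...   | just x  = sym (dec-false (x ≟ u) λ { refl → y≢u (sym (to-from from-y)) })

  extend-addArc : (H : Arcs n) (K : Arcs N) (u v : Fin n) → extend (addArc H u v) K ≐ addArc (extend H K) (to u) (to v)
  extend-addArc H K u v y z rewrite does-≟-to y u | does-≟-to z v with from y | from z
  ... | just x  | just x′ = refl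
  ... | just x  | nothing = sym (∧-zeroʳ (does (x ≟ u)))
  ... | nothing | just _  = refl
  ... | nothing | nothing = sym (∨-identityʳ (K y z))

  extend-exchangeable : {H : Arcs n} {u v : Fin n} (K : Arcs N) → Exchangeable H u v → Exchangeable (extend H K) (to u) (to v)
  extend-exchangeable {H} {u} {v} K ex = record
    { automorphism = extendPermutation automorphism
    ; preserves    = preserves′
    ; sends-u      = trans (cong (Maybe.maybe _ (to u)) (from-to u)) (cong to sends-u)
    ; sends-v      = trans (cong (Maybe.maybe _ (to v)) (from-to v)) (cong to sends-v)
    ; u≢v          = λ tu≡tv → u≢v (Maybeₚ.just-injective (trans (sym (from-to u)) (trans (cong from tu≡tv) (from-to v))))
    ; no-uv        = trans (extend-to H K u v) no-uv
    ; no-vu        = trans (extend-to H K v u) no-vu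
    }
    where
    open Exchangeable ex
    preserves′ : relabel (extendPermutation automorphism) (extend H K) ≐ extend H K
    preserves′ y z rewrite from-extendFun (automorphism ⟨$⟩ʳ_) y | from-extendFun (automorphism ⟨$⟩ʳ_) z
      with from y | from z
    ... | just x  | just x′ = preserves x x′
    ... | just _  | nothing = refl
    ... | nothing | just _  = refl
    ... | nothing | nothing = refl

  extend-derivation : {G₀ G : Arcs n} (K : Arcs N) → Derivation G₀ G m → Derivation (extend G₀ K) (extend G K) m
  extend-derivation K []               = []
  extend-derivation K (_▷_ {H} {u = u} {v} d ex) =
    reshape (extend-derivation K d ▷ extend-exchangeable K ex) (λ y z → sym (extend-addArc H K u v y z))
  extend-derivation K (reshape d G≐G′) = reshape (extend-derivation K d) (extend-cong K G≐G′)

sumArcs : {a b : ℕ} → Arcs a → Arcs b → Fin a ⊎ Fin b → Fin a ⊎ Fin b → Bool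
sumArcs G H (inj₁ x) (inj₁ x′) = G x x′
sumArcs G H (inj₂ y) (inj₂ y′) = H y y′
sumArcs G H (inj₁ _) (inj₂ _)  = false
sumArcs G H (inj₂ _) (inj₁ _)  = false

infixr 6 _⊕_
_⊕_ : {a b : ℕ} → Arcs a → Arcs b → Arcs (a + b)
_⊕_ {a} G H y z = sumArcs G H (splitAt a y) (splitAt a z)

inl-embedding : ∀ a b → Embedding a (a + b)
inl-embedding a b = record
  { to      = _↑ˡ b
  ; from    = Sum.[ just , const nothing ]′ ∘ splitAt a
  ; from-to = λ x → cong Sum.[ just , const nothing ]′ (Finₚ.splitAt-↑ˡ a x b)
  ; to-from = to-from
  }
  where
  to-from : ∀ {y x} → Sum.[ just , const nothing ]′ (splitAt a y) ≡ just x → x ↑ˡ b ≡ y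
  to-from {y} eq with splitAt a y in split-y
  to-from refl | inj₁ _ = Finₚ.splitAt⁻¹-↑ˡ split-y

inr-embedding : ∀ a b → Embedding b (a + b)
inr-embedding a b = record
  { to      = a ↑ʳ_
  ; from    = Sum.[ const nothing , just ]′ ∘ splitAt a
  ; from-to = λ x → cong Sum.[ const nothing , just ]′ (Finₚ.splitAt-↑ʳ a b x)
  ; to-from = to-from
  }
  where
  to-from : ∀ {y x} → Sum.[ const nothing , just ]′ (splitAt a y) ≡ just x → a ↑ʳ x ≡ y
  to-from {y} eq with splitAt a y in split-y
  to-from refl | inj₂ _ = Finₚ.splitAt⁻¹-↑ʳ split-y

module Left  {a b : ℕ} = Extension (inl-embedding a b)
module Right {a b : ℕ} = Extension (inr-embedding a b)

extendˡ-⊕ : {a b : ℕ} (G G′ : Arcs a) (H : Arcs b) → Left.extend G (G′ ⊕ H) ≐ G ⊕ H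
extendˡ-⊕ {a} G G′ H y z with splitAt a y in split-y | splitAt a z in split-z
... | inj₁ _ | inj₁ _ = refl
... | inj₁ _ | inj₂ _ = refl
... | inj₂ _ | inj₁ _ = refl
... | inj₂ _ | inj₂ _ = cong₂ (sumArcs G′ H) split-y split-z

extendʳ-⊕ : {a b : ℕ} (H : Arcs b) (G : Arcs a) (H′ : Arcs b) → Right.extend H (G ⊕ H′) ≐ G ⊕ H
extendʳ-⊕ {a} H G H′ y z with splitAt a y in split-y | splitAt a z in split-z
... | inj₁ _ | inj₁ _ = cong₂ (sumArcs G H′) split-y split-z
... | inj₁ _ | inj₂ _ = refl
... | inj₂ _ | inj₁ _ = refl
... | inj₂ _ | inj₂ _ = refl

noArcs-⊕ : {a b : ℕ} → noArcs {a} ⊕ noArcs {b} ≐ noArcs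
noArcs-⊕ {a} y z with splitAt a y | splitAt a z
... | inj₁ _ | inj₁ _ = refl
... | inj₁ _ | inj₂ _ = refl
... | inj₂ _ | inj₁ _ = refl
... | inj₂ _ | inj₂ _ = refl

derivation-⊕ : {a b m₁ m₂ : ℕ} {G : Arcs a} {H : Arcs b} →
  Derivation noArcs G m₁ → Derivation noArcs H m₂ → Derivation noArcs (G ⊕ H) (m₂ + m₁)
derivation-⊕ {a} {b} {m₁} {m₂} {G} {H} d₁ d₂ = left ++ᵈ right
  where
  left : Derivation noArcs (G ⊕ noArcs) m₁
  left = reshape (reshape-source (λ y z → trans (extendˡ-⊕ {a} {b} noArcs noArcs noArcs y z) (noArcs-⊕ {a} {b} y z))
                   (Left.extend-derivation {a} {b} (noArcs {a} ⊕ noArcs {b}) d₁))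
                 (extendˡ-⊕ G noArcs noArcs)
  right : Derivation (G ⊕ noArcs) (G ⊕ H) m₂
  right = reshape (reshape-source (extendʳ-⊕ noArcs G noArcs) (Right.extend-derivation {a} {b} (G ⊕ noArcs) d₂))
                  (extendʳ-⊕ H G noArcs)

binomialTreeSize : ℕ → ℕ
binomialTreeSize zero    = 1
binomialTreeSize (suc k) = binomialTreeSize k + binomialTreeSize k

binomialTreeArcs : ℕ → ℕ
binomialTreeArcs zero    = 0
binomialTreeArcs (suc k) = suc (binomialTreeArcs k + binomialTreeArcs k)

root : ∀ k → Fin (binomialTreeSize k)
root zero    = Fin.zero
root (suc k) = root k ↑ˡ binomialTreeSize k

binomialTree : ∀ k → Arcs (binomialTreeSize k)
binomialTree zero    = noArcs
binomialTree (suc k) = addArc (binomialTree k ⊕ binomialTree k) (root k ↑ˡ s) (s ↑ʳ root k)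
  where s = binomialTreeSize k

swapHalves : ∀ s → Permutation′ (s + s)
swapHalves s = Permutation.permutation swap swap swap-involutive swap-involutive
  where
  swap : Fin (s + s) → Fin (s + s)
  swap y = join s s (Sum.swap (splitAt s y))
  swap-involutive : ∀ y → swap (swap y) ≡ y
  swap-involutive y rewrite Finₚ.splitAt-join s s (Sum.swap (splitAt s y)) | Sumₚ.swap-involutive (splitAt s y) =
    Finₚ.join-splitAt s s y

roots-exchangeable : ∀ {s} (T : Arcs s) (r : Fin s) → Exchangeable (T ⊕ T) (r ↑ˡ s) (s ↑ʳ r)
roots-exchangeable {s} T r = record
  { automorphism = swapHalves s
  ; preserves    = preserves
  ; sends-u      = cong (join s s ∘ Sum.swap) (Finₚ.splitAt-↑ˡ s r s)
  ; sends-v      = cong (join s s ∘ Sum.swap) (Finₚ.splitAt-↑ʳ s s r)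
  ; u≢v          = λ eq → inj₁≢inj₂ (trans (sym (Finₚ.splitAt-↑ˡ s r s)) (trans (cong (splitAt s) eq) (Finₚ.splitAt-↑ʳ s s r)))
  ; no-uv        = cong₂ (sumArcs T T) (Finₚ.splitAt-↑ˡ s r s) (Finₚ.splitAt-↑ʳ s s r)
  ; no-vu        = cong₂ (sumArcs T T) (Finₚ.splitAt-↑ʳ s s r) (Finₚ.splitAt-↑ˡ s r s)
  }
  where
  inj₁≢inj₂ : {x y : Fin s} → inj₁ x ≢ inj₂ y
  inj₁≢inj₂ ()
  preserves : relabel (swapHalves s) (T ⊕ T) ≐ T ⊕ T
  preserves y z rewrite Finₚ.splitAt-join s s (Sum.swap (splitAt s y)) | Finₚ.splitAt-join s s (Sum.swap (splitAt s z))
    with splitAt s y | splitAt s z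
  ... | inj₁ _ | inj₁ _ = refl
  ... | inj₁ _ | inj₂ _ = refl
  ... | inj₂ _ | inj₁ _ = refl
  ... | inj₂ _ | inj₂ _ = refl

binomialTree-derivation : ∀ k → Derivation noArcs (binomialTree k) (binomialTreeArcs k)
binomialTree-derivation zero    = []
binomialTree-derivation (suc k) =
  derivation-⊕ (binomialTree-derivation k) (binomialTree-derivation k) ▷ roots-exchangeable (binomialTree k) (root k)

forestSize : List ℕ → ℕ
forestSize []       = 0
forestSize (k ∷ ks) = binomialTreeSize k + forestSize ks

forestArcs : List ℕ → ℕ
forestArcs []       = 0
forestArcs (k ∷ ks) = forestArcs ks + binomialTreeArcs k

binomialForest : ∀ ks → Arcs (forestSize ks)
binomialForest []       = noArcs
binomialForest (k ∷ ks) = binomialTree k ⊕ binomialForest ks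

binomialForest-derivation : ∀ ks → Derivation noArcs (binomialForest ks) (forestArcs ks)
binomialForest-derivation []       = []
binomialForest-derivation (k ∷ ks) = derivation-⊕ (binomialTree-derivation k) (binomialForest-derivation ks)

binomialTreeArcs+1 : ∀ k → binomialTreeArcs k + 1 ≡ binomialTreeSize k
binomialTreeArcs+1 zero    = refl
binomialTreeArcs+1 (suc k) =
  trans (rearrange (binomialTreeArcs k)) (cong₂ _+_ (binomialTreeArcs+1 k) (binomialTreeArcs+1 k))
  where
  rearrange : ∀ a → suc (a + a) + 1 ≡ (a + 1) + (a + 1)
  rearrange = solve-∀

forestArcs+length : ∀ ks → forestArcs ks + length ks ≡ forestSize ks
forestArcs+length []       = refl
forestArcs+length (k ∷ ks) =
  trans (rearrange (forestArcs ks) (binomialTreeArcs k) (length ks)) (cong₂ _+_ (binomialTreeArcs+1 k) (forestArcs+length ks))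
  where
  rearrange : ∀ f a l → (f + a) + suc l ≡ (a + 1) + (f + l)
  rearrange = solve-∀

-- Binary digits and the 2-adic valuation of n!

2-prime : Prime 2
2-prime = from-yes (prime? 2)

∤-* : ∀ {p a b} → Prime p → p ∤ a → p ∤ b → p ∤ a * b
∤-* {a = a} {b} p-prime p∤a p∤b p∣ab = Sum.[ p∤a , p∤b ]′ (euclidsLemma a b p-prime p∣ab)

2∤1+2q : ∀ q → 2 ∤ suc (q * 2)
2∤1+2q q 2∣1+2q with () ← ∣1⇒≡1 (∣m+n∣m⇒∣n (subst (2 ∣_) (+-comm 1 (q * 2)) 2∣1+2q) (n∣m*n q))

factorial-double : ∀ q → ∃ λ o → 2 ∤ o × (q * 2) ! ≡ 2 ^ q * q ! * o
factorial-double zero    = 1 , 2∤1+2q 0 , refl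
factorial-double (suc q) with o , 2∤o , eq ← factorial-double q =
  suc (q * 2) * o , ∤-* 2-prime (2∤1+2q q) 2∤o , (begin
    (2 + q * 2) !                                            ≡⟨⟩
    (2 + q * 2) * (suc (q * 2) * (q * 2) !)                  ≡⟨ cong (λ f → (2 + q * 2) * (suc (q * 2) * f)) eq ⟩
    (2 + q * 2) * (suc (q * 2) * (2 ^ q * q ! * o))          ≡⟨ rearrange q (2 ^ q) (q !) o ⟩
    2 ^ suc q * suc q ! * (suc (q * 2) * o)                  ∎)
  where
  open ≡-Reasoning
  rearrange : ∀ q P F o → (2 + q * 2) * (suc (q * 2) * (P * F * o)) ≡ (2 * P) * (F + q * F) * (suc (q * 2) * o)
  rearrange = solve-∀

factorial-halving : ∀ r q → r ≤ 1 → ∃ λ o → 2 ∤ o × (r + q * 2) ! ≡ 2 ^ q * q ! * o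
factorial-halving zero    q _ = factorial-double q
factorial-halving (suc zero) q _ with o , 2∤o , eq ← factorial-double q =
  suc (q * 2) * o , ∤-* 2-prime (2∤1+2q q) 2∤o , (begin
    suc (q * 2) * (q * 2) !            ≡⟨ cong (suc (q * 2) *_) eq ⟩
    suc (q * 2) * (2 ^ q * q ! * o)    ≡⟨ rearrange (suc (q * 2)) (2 ^ q * q !) o ⟩
    2 ^ q * q ! * (suc (q * 2) * o)    ∎)
  where
  open ≡-Reasoning
  rearrange : ∀ a b c → a * (b * c) ≡ b * (a * c)
  rearrange = solve-∀
factorial-halving (suc (suc _)) q (s≤s ())

s2-aux-zero : ∀ f → s2-aux f 0 ≡ 0
s2-aux-zero zero    = refl
s2-aux-zero (suc f) = s2-aux-zero f

%2≤1 : ∀ m → m % 2 ≤ 1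
%2≤1 m = ≤-pred (m%n<n m 2)

half<suc : ∀ m → suc m / 2 < suc m
half<suc m = m/n<m (suc m) 2 (s≤s (s≤s z≤n))

half≤fuel : ∀ {m f} → m ≤ suc f → m / 2 ≤ f
half≤fuel {zero}  _     = z≤n
half≤fuel {suc m} m≤1+f = ≤-pred (≤-trans (half<suc m) m≤1+f)

s2-aux-fuel : ∀ {f f′ m} → m ≤ f → m ≤ f′ → s2-aux f m ≡ s2-aux f′ m
s2-aux-fuel {f} {f′} {zero} _ _ = trans (s2-aux-zero f) (sym (s2-aux-zero f′))
s2-aux-fuel {suc f} {suc f′} {suc m} m≤f m≤f′ = cong (suc m % 2 +_) (s2-aux-fuel (half≤fuel m≤f) (half≤fuel m≤f′))

s2-suc : ∀ n → s2 (suc n) ≡ suc n % 2 + s2 (suc n / 2)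
s2-suc n = cong (suc n % 2 +_) (s2-aux-fuel {n} (half≤fuel ≤-refl) ≤-refl)

s2-aux≤ : ∀ f m → s2-aux f m ≤ m
s2-aux≤ zero    m = z≤n
s2-aux≤ (suc f) m = begin
  m % 2 + s2-aux f (m / 2) ≤⟨ +-monoʳ-≤ (m % 2) (s2-aux≤ f (m / 2)) ⟩
  m % 2 + m / 2            ≤⟨ +-monoʳ-≤ (m % 2) (m≤m*n (m / 2) 2) ⟩
  m % 2 + m / 2 * 2        ≡⟨ m≡m%n+[m/n]*n m 2 ⟨
  m                        ∎
  where open ≤-Reasoning

s2≤ : ∀ n → s2 n ≤ n
s2≤ n = s2-aux≤ n n

factorial-2-adic : ∀ n → ∃ λ o → 2 ∤ o × n ! ≡ 2 ^ (n ∸ s2 n) * o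
factorial-2-adic = <-rec _ step
  where
  step : ∀ n → (∀ {m} → m < n → ∃ λ o → 2 ∤ o × m ! ≡ 2 ^ (m ∸ s2 m) * o) → ∃ λ o → 2 ∤ o × n ! ≡ 2 ^ (n ∸ s2 n) * o
  step zero    _   = 1 , 2∤1+2q 0 , refl
  step (suc n) rec
    with o₁ , 2∤o₁ , eq₁ ← factorial-halving (suc n % 2) (suc n / 2) (%2≤1 (suc n))
       | o₂ , 2∤o₂ , eq₂ ← rec (half<suc n) =
    o₂ * o₁ , ∤-* 2-prime 2∤o₂ 2∤o₁ , (begin
      N !                                  ≡⟨ cong _! (m≡m%n+[m/n]*n N 2) ⟩
      (r + q * 2) !                        ≡⟨ eq₁ ⟩
      2 ^ q * q ! * o₁                     ≡⟨ cong (λ f → 2 ^ q * f * o₁) eq₂ ⟩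
      2 ^ q * (2 ^ (q ∸ s2 q) * o₂) * o₁   ≡⟨ rearrange (2 ^ q) (2 ^ (q ∸ s2 q)) o₂ o₁ ⟩
      2 ^ q * 2 ^ (q ∸ s2 q) * (o₂ * o₁)   ≡⟨ cong (_* (o₂ * o₁)) (^-distribˡ-+-* 2 q (q ∸ s2 q)) ⟨
      2 ^ (q + (q ∸ s2 q)) * (o₂ * o₁)     ≡⟨ cong (λ e → 2 ^ e * (o₂ * o₁)) exponent ⟨
      2 ^ (N ∸ s2 N) * (o₂ * o₁)           ∎)
    where
    open ≡-Reasoning
    N q r : ℕ
    N = suc n
    q = N / 2
    r = N % 2
    rearrange : ∀ a b c d → a * (b * c) * d ≡ a * b * (c * d)
    rearrange = solve-∀
    exponent : N ∸ s2 N ≡ q + (q ∸ s2 q)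
    exponent = begin
      N ∸ s2 N                 ≡⟨ cong₂ _∸_ (m≡m%n+[m/n]*n N 2) (s2-suc n) ⟩
      (r + q * 2) ∸ (r + s2 q) ≡⟨ [m+n]∸[m+o]≡n∸o r (q * 2) (s2 q) ⟩
      q * 2 ∸ s2 q             ≡⟨ cong (_∸ s2 q) (trans (*-comm q 2) (cong (q +_) (+-identityʳ q))) ⟩
      (q + q) ∸ s2 q           ≡⟨ +-∸-assoc q (s2≤ q) ⟩
      q + (q ∸ s2 q)           ∎

^-∣-^ : ∀ c {a b} → a ≤ b → c ^ a ∣ c ^ b
^-∣-^ c {a} {b} a≤b = divides (c ^ (b ∸ a)) (begin
  c ^ b               ≡⟨ cong (c ^_) (m+[n∸m]≡n a≤b) ⟨
  c ^ (a + (b ∸ a))   ≡⟨ ^-distribˡ-+-* c a (b ∸ a) ⟩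
  c ^ a * c ^ (b ∸ a) ≡⟨ *-comm (c ^ a) _ ⟩
  c ^ (b ∸ a) * c ^ a ∎)
  where open ≡-Reasoning

2^-∣-odd : ∀ {m v o} → 2 ∤ o → 2 ^ m ∣ 2 ^ v * o → m ≤ v
2^-∣-odd {m} {v} {o} 2∤o 2^m∣2^v*o with m ≤? v
... | yes m≤v = m≤v
... | no  m≰v = ⊥-elim (2∤o (*-cancelˡ-∣ (2 ^ v) {{m^n≢0 2 v}}
  (∣-trans (subst (_∣ 2 ^ m) (*-comm 2 (2 ^ v)) (^-∣-^ 2 (≰⇒> m≰v))) 2^m∣2^v*o)))

prependIf : ℕ → ℕ → List ℕ → List ℕ
prependIf zero    k ks = ks
prependIf (suc _) k ks = k ∷ ks

-- The exponents (offset by k) of the binary digits of m, recursing exactly like s2-aux.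
binaryExponentsFrom : ℕ → ℕ → ℕ → List ℕ
binaryExponentsFrom zero    m k = []
binaryExponentsFrom (suc f) m k = prependIf (m % 2) k (binaryExponentsFrom f (m / 2) (suc k))

binaryExponents : ℕ → List ℕ
binaryExponents n = binaryExponentsFrom n n 0

length-binaryExponentsFrom : ∀ f m k → length (binaryExponentsFrom f m k) ≡ s2-aux f m
length-binaryExponentsFrom zero    m k = refl
length-binaryExponentsFrom (suc f) m k with m % 2 | %2≤1 m
... | zero     | _ = length-binaryExponentsFrom f (m / 2) (suc k)
... | suc zero | _ = cong suc (length-binaryExponentsFrom f (m / 2) (suc k))
... | suc (suc _) | s≤s ()

forestSize-binaryExponentsFrom : ∀ f m k → m ≤ f → forestSize (binaryExponentsFrom f m k) ≡ m * binomialTreeSize k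
forestSize-binaryExponentsFrom zero    zero k _   = refl
forestSize-binaryExponentsFrom (suc f) m    k m≤f = begin
  forestSize (prependIf (m % 2) k rest)
    ≡⟨ forestSize-prependIf (m % 2) (%2≤1 m) ⟩
  m % 2 * binomialTreeSize k + forestSize rest
    ≡⟨ cong (m % 2 * binomialTreeSize k +_) (forestSize-binaryExponentsFrom f (m / 2) (suc k) (half≤fuel m≤f)) ⟩
  m % 2 * binomialTreeSize k + m / 2 * (binomialTreeSize k + binomialTreeSize k)
    ≡⟨ rearrange (m % 2) (m / 2) (binomialTreeSize k) ⟩
  (m % 2 + m / 2 * 2) * binomialTreeSize k
    ≡⟨ cong (_* binomialTreeSize k) (m≡m%n+[m/n]*n m 2) ⟨
  m * binomialTreeSize k ∎
  where
  open ≡-Reasoning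
  rest : List ℕ
  rest = binaryExponentsFrom f (m / 2) (suc k)
  rearrange : ∀ r q s → r * s + q * (s + s) ≡ (r + q * 2) * s
  rearrange = solve-∀
  forestSize-prependIf : ∀ r → r ≤ 1 → forestSize (prependIf r k rest) ≡ r * binomialTreeSize k + forestSize rest
  forestSize-prependIf zero       _ = refl
  forestSize-prependIf (suc zero) _ = cong (_+ forestSize rest) (sym (+-identityʳ _))
  forestSize-prependIf (suc (suc _)) (s≤s ())

forestSize-binaryExponents : ∀ n → forestSize (binaryExponents n) ≡ n
forestSize-binaryExponents n = trans (forestSize-binaryExponentsFrom n n 0 ≤-refl) (*-identityʳ n)

forestArcs-binaryExponents : ∀ n → forestArcs (binaryExponents n) ≡ n ∸ s2 n
forestArcs-binaryExponents n = begin
  forestArcs ks                          ≡⟨ m+n∸n≡m (forestArcs ks) (s2 n) ⟨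
  forestArcs ks + s2 n ∸ s2 n            ≡⟨ cong (λ l → forestArcs ks + l ∸ s2 n) (length-binaryExponentsFrom n n 0) ⟨
  forestArcs ks + length ks ∸ s2 n       ≡⟨ cong (_∸ s2 n) (trans (forestArcs+length ks) (forestSize-binaryExponents n)) ⟩
  n ∸ s2 n                               ∎
  where
  open ≡-Reasoning
  ks : List ℕ
  ks = binaryExponents n

binomialForest-digraph : ∀ ks → Digraph (forestSize ks)
binomialForest-digraph ks = record
  { arc      = binomialForest ks
  ; loopless = derivation-loopless (λ _ → refl) (binomialForest-derivation ks)
  }

binomial-digraph : ∀ n → ∃ λ (D : Digraph n) → ∀ k → 2 ^ (n ∸ s2 n) * descentCount (arc D) k ≡ n ! * ((n ∸ s2 n) C k)
binomial-digraph n = subst (λ N → ∃ λ (D : Digraph N) → ∀ k → 2 ^ e * descentCount (arc D) k ≡ N ! * (e C k))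
  (forestSize-binaryExponents n)
  (binomialForest-digraph ks , subst (λ a → ∀ k → 2 ^ a * descentCount (binomialForest ks) k ≡ forestSize ks ! * (a C k))
    (forestArcs-binaryExponents n) (binomial-descents (binomialForest-derivation ks)))
  where
  ks : List ℕ
  ks = binaryExponents n
  e : ℕ
  e = n ∸ s2 n

-- Polynomials

-- Opened only now: with ℤ's +_ in scope, sections of ℕ's _+_ such as (x +_) no longer parse.
open import Data.Integer using (+_)

coeff-+P : ∀ p q k → coeff (p +P q) k ≡ coeff p k ℤ.+ coeff q k
coeff-+P []      q       k       = sym (ℤₚ.+-identityˡ (coeff q k))
coeff-+P (a ∷ p) []      k       = sym (ℤₚ.+-identityʳ (coeff (a ∷ p) k))
coeff-+P (a ∷ p) (b ∷ q) zero    = refl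
coeff-+P (a ∷ p) (b ∷ q) (suc k) = coeff-+P p q k

coeff-scale : ∀ a p k → coeff (scale a p) k ≡ a ℤ.* coeff p k
coeff-scale a []      k       = sym (ℤₚ.*-zeroʳ a)
coeff-scale a (b ∷ p) zero    = refl
coeff-scale a (b ∷ p) (suc k) = coeff-scale a p k

coeff-onePlusT-*P : ∀ q k → coeff (onePlusT *P q) k ≡ coeff q k ℤ.+ coeff (+ 0 ∷ q) k
coeff-onePlusT-*P q k = begin
  coeff (scale (+ 1) q +P (+ 0 ∷ (scale (+ 1) q +P (+ 0 ∷ [])))) k
    ≡⟨ coeff-+P (scale (+ 1) q) _ k ⟩
  coeff (scale (+ 1) q) k ℤ.+ coeff (+ 0 ∷ (scale (+ 1) q +P (+ 0 ∷ []))) k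
    ≡⟨ cong₂ ℤ._+_ (trans (coeff-scale (+ 1) q k) (ℤₚ.*-identityˡ _)) (tail-coeff k) ⟩
  coeff q k ℤ.+ coeff (+ 0 ∷ q) k ∎
  where
  open ≡-Reasoning
  tail-coeff : ∀ k → coeff (+ 0 ∷ (scale (+ 1) q +P (+ 0 ∷ []))) k ≡ coeff (+ 0 ∷ q) k
  tail-coeff zero    = refl
  tail-coeff (suc k) = begin
    coeff (scale (+ 1) q +P (+ 0 ∷ [])) k        ≡⟨ coeff-+P (scale (+ 1) q) _ k ⟩
    coeff (scale (+ 1) q) k ℤ.+ coeff (+ 0 ∷ []) k ≡⟨ cong₂ ℤ._+_ (trans (coeff-scale (+ 1) q k) (ℤₚ.*-identityˡ _)) (zero-coeff k) ⟩
    coeff q k ℤ.+ + 0                            ≡⟨ ℤₚ.+-identityʳ _ ⟩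
    coeff q k                                    ∎
    where
    zero-coeff : ∀ k → coeff (+ 0 ∷ []) k ≡ + 0
    zero-coeff zero    = refl
    zero-coeff (suc k) = refl

coeff-onePlusT^P : ∀ m k → coeff (onePlusT ^P m) k ≡ + (m C k)
coeff-onePlusT^P zero    zero    = refl
coeff-onePlusT^P zero    (suc k) = refl
coeff-onePlusT^P (suc m) k = begin
  coeff (onePlusT *P (onePlusT ^P m)) k                             ≡⟨ coeff-onePlusT-*P (onePlusT ^P m) k ⟩
  coeff (onePlusT ^P m) k ℤ.+ coeff (+ 0 ∷ onePlusT ^P m) k         ≡⟨ cong₂ ℤ._+_ (coeff-onePlusT^P m k) (shifted k) ⟩
  + (m C k) ℤ.+ + shift (m C_) k                                    ≡⟨ cong +_ (pascal-shift m k) ⟩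
  + (suc m C k)                                                     ∎
  where
  open ≡-Reasoning
  shifted : ∀ k → coeff (+ 0 ∷ onePlusT ^P m) k ≡ + shift (m C_) k
  shifted zero    = refl
  shifted (suc k) = coeff-onePlusT^P m k

eval1 : Poly → ℤ
eval1 []      = + 0
eval1 (a ∷ p) = a ℤ.+ eval1 p

eval1-+P : ∀ p q → eval1 (p +P q) ≡ eval1 p ℤ.+ eval1 q
eval1-+P []      q       = sym (ℤₚ.+-identityˡ _)
eval1-+P (a ∷ p) []      = sym (ℤₚ.+-identityʳ _)
eval1-+P (a ∷ p) (b ∷ q) = trans (cong (ℤ._+_ (a ℤ.+ b)) (eval1-+P p q)) (rearrange a b (eval1 p) (eval1 q))
  where
  rearrange : ∀ a b x y → (a ℤ.+ b) ℤ.+ (x ℤ.+ y) ≡ (a ℤ.+ x) ℤ.+ (b ℤ.+ y)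
  rearrange = ℤ-Solver.solve-∀

eval1-scale : ∀ a p → eval1 (scale a p) ≡ a ℤ.* eval1 p
eval1-scale a []      = sym (ℤₚ.*-zeroʳ a)
eval1-scale a (b ∷ p) = trans (cong (ℤ._+_ (a ℤ.* b)) (eval1-scale a p)) (sym (ℤₚ.*-distribˡ-+ a b (eval1 p)))

eval1-*P : ∀ p q → eval1 (p *P q) ≡ eval1 p ℤ.* eval1 q
eval1-*P []      q = refl
eval1-*P (a ∷ p) q = begin
  eval1 (scale a q +P (+ 0 ∷ (p *P q)))                 ≡⟨ eval1-+P (scale a q) _ ⟩
  eval1 (scale a q) ℤ.+ (+ 0 ℤ.+ eval1 (p *P q))        ≡⟨ cong₂ (λ x y → x ℤ.+ (+ 0 ℤ.+ y)) (eval1-scale a q) (eval1-*P p q) ⟩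
  a ℤ.* eval1 q ℤ.+ (+ 0 ℤ.+ eval1 p ℤ.* eval1 q)       ≡⟨ rearrange a (eval1 p) (eval1 q) ⟩
  (a ℤ.+ eval1 p) ℤ.* eval1 q                           ∎
  where
  open ≡-Reasoning
  rearrange : ∀ a x y → a ℤ.* y ℤ.+ (+ 0 ℤ.+ x ℤ.* y) ≡ (a ℤ.+ x) ℤ.* y
  rearrange = ℤ-Solver.solve-∀

eval1-onePlusT^P : ∀ m → eval1 (onePlusT ^P m) ≡ + (2 ^ m)
eval1-onePlusT^P zero    = refl
eval1-onePlusT^P (suc m) = begin
  eval1 (onePlusT *P (onePlusT ^P m))    ≡⟨ eval1-*P onePlusT (onePlusT ^P m) ⟩
  + 2 ℤ.* eval1 (onePlusT ^P m)          ≡⟨ cong (ℤ._*_ (+ 2)) (eval1-onePlusT^P m) ⟩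
  + 2 ℤ.* + (2 ^ m)                      ≡⟨ ℤₚ.pos-* 2 (2 ^ m) ⟨
  + (2 ^ suc m)                          ∎
  where open ≡-Reasoning

-- Trailing zero coefficients do not change the value at 1.
eval1-cong : ∀ p q → p ≈P q → eval1 p ≡ eval1 q
eval1-cong []      []      p≈q = refl
eval1-cong []      (b ∷ q) p≈q = cong₂ ℤ._+_ (p≈q 0) (eval1-cong [] q (p≈q ∘ suc))
eval1-cong (a ∷ p) []      p≈q = cong₂ ℤ._+_ (p≈q 0) (eval1-cong p [] (p≈q ∘ suc))
eval1-cong (a ∷ p) (b ∷ q) p≈q = cong₂ ℤ._+_ (p≈q 0) (eval1-cong p q (p≈q ∘ suc))

eval1-map-+ : (f : X → ℕ) (xs : List X) → eval1 (map (λ x → + f x) xs) ≡ + sum (map f xs)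
eval1-map-+ f []       = refl
eval1-map-+ f (x ∷ xs) = trans (cong (ℤ._+_ (+ f x)) (eval1-map-+ f xs)) (sym (ℤₚ.pos-+ (f x) _))

eval1-A : (D : Digraph n) → eval1 (A D) ≡ + (n !)
eval1-A {n} D = begin
  eval1 (A D)                                                           ≡⟨ eval1-map-+ (descentCount (arc D)) (upTo N) ⟩
  + sum (map (descentCount (arc D)) (upTo N))                           ≡⟨ cong +_ (sum-count-≡ᵇ (descents (arc D)) (allBijections n) N) ⟩
  + count (λ σ → descents (arc D) σ <ᵇ N) (allBijections n)             ≡⟨ cong +_ (count-cong (allBijections n) below) ⟩
  + count (λ _ → true) (allBijections n)                                ≡⟨ cong +_ (trans (count-true (allBijections n)) (length-allBijections n)) ⟩
  + (n !)                                                               ∎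
  where
  open ≡-Reasoning
  N : ℕ
  N = suc (n * n)
  below : ∀ σ → (descents (arc D) σ <ᵇ N) ≡ true
  below σ = Equivalence.to T-≡ (<⇒<ᵇ (s≤s (descents≤ (arc D) σ)))

coeff-map-applyUpTo : (g : ℕ → ℤ) (f : ℕ → ℕ) → ∀ N k → coeff (map g (applyUpTo f N)) k ≡ (if k <ᵇ N then g (f k) else + 0)
coeff-map-applyUpTo g f zero    k       = refl
coeff-map-applyUpTo g f (suc N) zero    = refl
coeff-map-applyUpTo g f (suc N) (suc k) = coeff-map-applyUpTo g (f ∘ suc) N k

descentCount-beyond : (G : Arcs n) → ∀ k → n * n < k → descentCount G k ≡ 0
descentCount-beyond {n} G k n*n<k = trans (count-cong (allBijections n) (λ σ → never σ)) (count-false (allBijections n))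
  where
  never : ∀ σ → (descents G σ ≡ᵇ k) ≡ false
  never σ with descents G σ ≡ᵇ k in eq
  ... | true  = ⊥-elim (<⇒≢ (≤-<-trans (descents≤ G σ) n*n<k) (≡ᵇ⇒≡ _ k (Equivalence.from T-≡ eq)))
  ... | false = refl

coeff-A : (D : Digraph n) → ∀ k → coeff (A D) k ≡ + descentCount (arc D) k
coeff-A {n} D k = trans (coeff-map-applyUpTo (λ k → + descentCount (arc D) k) id (suc (n * n)) k) within
  where
  within : (if k <ᵇ suc (n * n) then + descentCount (arc D) k else + 0) ≡ + descentCount (arc D) k
  within with k <ᵇ suc (n * n) in k<N
  ... | true  = refl
  ... | false = cong +_ (sym (descentCount-beyond (arc D) k (≰⇒> λ k≤n*n → subst T k<N (<⇒<ᵇ (s≤s k≤n*n)))))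

onePlusT^∣A⇒2^∣n! : (D : Digraph n) (m : ℕ) → (onePlusT ^P m) ∣P A D → 2 ^ m ∣ n !
onePlusT^∣A⇒2^∣n! {n} D m (q , q-witness) = divides ∣ eval1 q ∣ (begin
  n !                                   ≡⟨ cong ∣_∣ at-1 ⟨
  ∣ + (2 ^ m) ℤ.* eval1 q ∣             ≡⟨ ℤₚ.abs-* (+ (2 ^ m)) (eval1 q) ⟩
  2 ^ m * ∣ eval1 q ∣                   ≡⟨ *-comm (2 ^ m) _ ⟩
  ∣ eval1 q ∣ * 2 ^ m                   ∎)
  where
  open ≡-Reasoning
  at-1 : + (2 ^ m) ℤ.* eval1 q ≡ + (n !)
  at-1 = begin
    + (2 ^ m) ℤ.* eval1 q                 ≡⟨ cong (ℤ._* eval1 q) (eval1-onePlusT^P m) ⟨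
    eval1 (onePlusT ^P m) ℤ.* eval1 q     ≡⟨ eval1-*P (onePlusT ^P m) q ⟨
    eval1 ((onePlusT ^P m) *P q)          ≡⟨ eval1-cong ((onePlusT ^P m) *P q) (A D) q-witness ⟩
    eval1 (A D)                           ≡⟨ eval1-A D ⟩
    + (n !)                               ∎

A≈binomial : (D : Digraph n) (e : ℕ) → (∀ k → 2 ^ e * descentCount (arc D) k ≡ n ! * (e C k)) →
  A D ≈P scale (+ factDivPow2 n e) (onePlusT ^P e)
A≈binomial {n} D e law k = begin
  coeff (A D) k                                 ≡⟨ coeff-A D k ⟩
  + c k                                         ≡⟨ cong +_ (*-cancelˡ-≡ (c k) (o * (e C k)) (2 ^ e) {{m^n≢0 2 e}} (trans (law k) n!*eCk)) ⟩
  + (o * (e C k))                               ≡⟨ ℤₚ.pos-* o (e C k) ⟩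
  + o ℤ.* + (e C k)                             ≡⟨ cong₂ ℤ._*_ (cong +_ factDivPow2≡o) (coeff-onePlusT^P e k) ⟨
  + factDivPow2 n e ℤ.* coeff (onePlusT ^P e) k ≡⟨ coeff-scale (+ factDivPow2 n e) (onePlusT ^P e) k ⟨
  coeff (scale (+ factDivPow2 n e) (onePlusT ^P e)) k ∎
  where
  open ≡-Reasoning
  c : ℕ → ℕ
  c = descentCount (arc D)
  -- The law at k = 0 says that the constant coefficient is n! / 2^e.
  o : ℕ
  o = c 0
  n!≡2^e*o : n ! ≡ 2 ^ e * o
  n!≡2^e*o = trans (sym (*-identityʳ (n !))) (sym (law 0))
  n!*eCk : n ! * (e C k) ≡ 2 ^ e * (o * (e C k))
  n!*eCk = trans (cong (_* (e C k)) n!≡2^e*o) (*-assoc (2 ^ e) o (e C k))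
  factDivPow2≡o : factDivPow2 n e ≡ o
  factDivPow2≡o = trans (cong (λ f → (f / 2 ^ e) {{m^n≢0 2 e}}) (trans n!≡2^e*o (*-comm (2 ^ e) o))) (m*n/n≡m o (2 ^ e) {{m^n≢0 2 e}})

onePlusT-multiplicity≤ : (n : ℕ) (D : Digraph n) (m : ℕ) → (onePlusT ^P m) ∣P A D → m ≤ n ∸ s2 n
onePlusT-multiplicity≤ n D m divisible with o , 2∤o , n!≡2^v*o ← factorial-2-adic n =
  2^-∣-odd 2∤o (subst (2 ^ m ∣_) n!≡2^v*o (onePlusT^∣A⇒2^∣n! D m divisible))

theorem1p7 : ((n : ℕ) (D : Digraph n) (m : ℕ) → (onePlusT ^P m) ∣P A D → m ≤ n ∸ s2 n)
    × ((n : ℕ) → .{{_ : NonZero n}} → ∃ λ (D : Digraph n) →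
    A D ≈P scale (+ factDivPow2 n (n ∸ s2 n)) (onePlusT ^P (n ∸ s2 n)))
theorem1p7 = onePlusT-multiplicity≤ , λ n → let D , law = binomial-digraph n in D , A≈binomial D (n ∸ s2 n) law
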